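{- Let $g\in[0,d]$ and let $\mathbb I_g$ be the $\mathbb F$-span of $\{B_{g,a,g}: a\in[0,d],\ a\le_2\widetilde g,\ p\mid k_a\}$. Then $\mathbb I_g$ is a nilpotent two-sided ideal of the algebra $E_g^*\mathbb TE_g^*$, and its nilpotency index is $n(\mathbb I_g)=|\{a\in\mathbb P(g): u_a\equiv1\pmod p\}|+1$.
   Context: Let $n\ge1$ and let $\mathbb U_1,\dots,\mathbb U_n$ be finite sets with $|\mathbb U_a|=u_a\ge2$. Put $\mathbb X=\prod_a\mathbb U_a$, $d=2^n-1$. For $g\in[0,d]$ with binary expansion $g=\sum_{a=1}^n g_{(a)}2^{a-1}$ let $\mathbb P(g)=\{a:g_{(a)}=1\}$, and $R_g=\{(\mathbf u,\mathbf v)\in\mathbb X^2:\mathbf u_a\ne\mathbf v_a\iff a\in\mathbb P(g)\}$ (factorial association scheme); $k_g=|\{\mathbf w:(\mathbf u,\mathbf w)\in R_g\}|$. For $g,h\in[0,d]$: $g\le_2h$ iff $\mathbb P(g)\subseteq\mathbb P(h)$; $g\setminus h$, $g\cup h$ are the elements whose $\mathbb P$ is the difference, union; $g\oplus h=(g\setminus h)\cup(h\setminus g)$; $\widetilde g$ has $\mathbb P(\widetilde g)=\{a\in\mathbb P(g):u_a>2\}$. $\mathbb F$ is a field of characteristic $p$; "$p\mid m$" means $m\cdot1_{\mathbb F}=0$, "$u_a\equiv1\pmod p$" means $u_a\cdot1_{\mathbb F}=1_{\mathbb F}$. $A_g$ is the $\{0,1\}$ adjacency matrix of $R_g$ over $\mathbb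 F$; fixing $\mathbf x\in\mathbb X$, $E_g^*$ is the diagonal $\{0,1\}$-matrix with $E_g^*(\mathbf u,\mathbf u)=1$ iff $(\mathbf x,\mathbf u)\in R_g$; $\mathbb T$ is the subalgebra of $M_{\mathbb X}(\mathbb F)$ generated by all $A_g,E_g^*$, and $E_g^*\mathbb TE_g^*=\{E_g^*ME_g^*:M\in\mathbb T\}$. $B_{g,h,i}=\sum_{j:\ g\oplus i\le_2j\le_2h}E_g^*A_jE_i^*$. For a nilpotent ideal $\mathbb I$, $n(\mathbb I)$ is the smallest $h\ge1$ such that any product of $h$ elements of $\mathbb I$ is zero. -}

module Defs where

open import Level using (Level; _⊔_; Lift) renaming (suc to lsuc)
open import Data.Nat using (ℕ; zero; suc; _<ᵇ_)
open import Data.Bool using (Bool; true; false; if_then_else_; _∧_; not; _xor_)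
open import Data.Fin using (Fin; zero; suc; _≟_)
open import Data.Fin.Subset using (Subset; inside; outside; _∪_; _─_; _⊆_)
open import Data.Fin.Subset.Properties using (_⊆?_)
open import Data.List using (List; []; _∷_; [_]; map; concatMap; _++_; foldr; length; filterᵇ; allFin)
open import Data.Bool.ListAction using (and)
open import Data.Vec using (Vec; lookup; tabulate)
open import Data.Product using (Σ; _×_; ∃)
open import Relation.Nullary using (¬_; ⌊_⌋)
open import Algebra.Bundles using (CommutativeRing)

record Field (c ℓ : Level) : Set (lsuc (c ⊔ ℓ)) where
  field
    commutativeRing : CommutativeRing c ℓ
  open CommutativeRing commutativeRing public
  field
    1≉0     : ¬ (1# ≈ 0#)
    inverse : ∀ x → ¬ (x ≈ 0#) → ∃ λ y → x * y ≈ 1#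

Pt : (n : ℕ) → (Fin n → ℕ) → Set
Pt n u = (a : Fin n) → Fin (u a)

consPt : ∀ {n} {u : Fin (suc n) → ℕ} → Fin (u zero) →
         ((a : Fin n) → Fin (u (suc a))) → Pt (suc n) u
consPt i f zero    = i
consPt i f (suc a) = f a

allPt : (n : ℕ) (u : Fin n → ℕ) → List (Pt n u)
allPt zero    u = [ (λ ()) ]
allPt (suc n) u =
  concatMap (λ i → map (consPt {u = u} i) (allPt n (λ a → u (suc a)))) (allFin (u zero))

-- All subsets of Fin n.  An index g ∈ [0,d] is encoded by its support P(g).
allSubsets : (n : ℕ) → List (Subset n)
allSubsets zero    = [ Data.Vec.[] ]
allSubsets (suc n) = map (outside Data.Vec.∷_) (allSubsets n) ++ map (inside Data.Vec.∷_) (allSubsets n)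

_⊕ˢ_ : ∀ {n} → Subset n → Subset n → Subset n
g ⊕ˢ h = (g ─ h) ∪ (h ─ g)

module Setting {c ℓ : Level} (F : Field c ℓ) (n : ℕ) (u : Fin n → ℕ) (x : Pt n u) where
  open Field F

  X : Set
  X = Pt n u

  allX : List X
  allX = allPt n u

  -- (v , w) ∈ R_g  iff  (v_a ≠ w_a ⇔ a ∈ P(g)) for every a
  inR : Subset n → X → X → Bool
  inR g v w = and (map (λ a → not (not ⌊ v a ≟ w a ⌋ xor lookup g a)) (allFin n))

  eqX : X → X → Bool
  eqX v w = and (map (λ a → ⌊ v a ≟ w a ⌋) (allFin n))

  k : Subset n → ℕ
  k g = length (filterᵇ (inR g x) allX)

  natF : ℕ → Carrier
  natF zero    = 0#
  natF (suc m) = 1# + natF m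

  tilde : Subset n → Subset n
  tilde g = tabulate (λ a → lookup g a ∧ (2 <ᵇ u a))

  Mat : Set c
  Mat = X → X → Carrier

  infix 4 _≈ₘ_
  _≈ₘ_ : Mat → Mat → Set ℓ
  M ≈ₘ N = ∀ v w → M v w ≈ N v w

  sumF : ∀ {A : Set} → List A → (A → Carrier) → Carrier
  sumF xs f = foldr (λ a r → f a + r) 0# xs

  infixl 6 _+ₘ_
  infixl 7 _*ₘ_
  infixr 7 _•_

  _+ₘ_ : Mat → Mat → Mat
  (M +ₘ N) v w = M v w + N v w

  _*ₘ_ : Mat → Mat → Mat
  (M *ₘ N) v w = sumF allX (λ z → M v z * N z w)

  _•_ : Carrier → Mat → Mat
  (λc • M) v w = λc * M v w

  0ₘ : Mat
  0ₘ v w = 0#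

  1ₘ : Mat
  1ₘ v w = if eqX v w then 1# else 0#

  sumₘ : ∀ {A : Set} → List A → (A → Mat) → Mat
  sumₘ xs f = foldr (λ a R → f a +ₘ R) 0ₘ xs

  A : Subset n → Mat
  A g v w = if inR g v w then 1# else 0#

  E* : Subset n → Mat
  E* g v w = if eqX v w ∧ inR g x v then 1# else 0#

  B : Subset n → Subset n → Subset n → Mat
  B g h i = sumₘ (filterᵇ (λ j → ⌊ (g ⊕ˢ i) ⊆? j ⌋ ∧ ⌊ j ⊆? h ⌋) (allSubsets n))
                 (λ j → E* g *ₘ A j *ₘ E* i)

  Pred : Set (lsuc (c ⊔ ℓ))
  Pred = Mat → Set (c ⊔ ℓ)

  data InT : Mat → Set (c ⊔ ℓ) where
    genA : ∀ g → InT (A g)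
    genE : ∀ g → InT (E* g)
    one  : InT 1ₘ
    add  : ∀ {M N} → InT M → InT N → InT (M +ₘ N)
    scal : ∀ λc {M} → InT M → InT (λc • M)
    mul  : ∀ {M N} → InT M → InT N → InT (M *ₘ N)
    resp : ∀ {M N} → InT M → M ≈ₘ N → InT N

  ETE : Subset n → Pred
  ETE g N = Σ Mat λ M → InT M × (N ≈ₘ E* g *ₘ M *ₘ E* g)

  data Span (S : Pred) : Mat → Set (c ⊔ ℓ) where
    zeroₛ : Span S 0ₘ
    gen   : ∀ {M} → S M → Span S M
    add   : ∀ {M N} → Span S M → Span S N → Span S (M +ₘ N)
    scal  : ∀ λc {M} → Span S M → Span S (λc • M)
    resp  : ∀ {M N} → Span S M → M ≈ₘ N → Span S N

  Igen : Subset n → Pred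
  Igen g N = Lift c (Σ (Subset n) λ a → a ⊆ tilde g × natF (k a) ≈ 0# × (N ≈ₘ B g a g))

  I : Subset n → Pred
  I g = Span (Igen g)

  record IsTwoSidedIdeal (Alg J : Pred) : Set (c ⊔ ℓ) where
    field
      sub    : ∀ {M} → J M → Alg M
      zeroJ  : J 0ₘ
      addJ   : ∀ {M N} → J M → J N → J (M +ₘ N)
      scalJ  : ∀ λc {M} → J M → J (λc • M)
      mulˡ   : ∀ {M N} → Alg N → J M → J (N *ₘ M)
      mulʳ   : ∀ {M N} → J M → Alg N → J (M *ₘ N)

  prodV : ∀ {h} → Vec Mat h → Mat
  prodV Data.Vec.[]       = 1ₘ
  prodV (M Data.Vec.∷ Ms) = M *ₘ prodV Ms

  ProdZero : Pred → ℕ → Set (c ⊔ ℓ)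
  ProdZero J h = (Ms : Vec Mat h) → (∀ i → J (lookup Ms i)) → prodV Ms ≈ₘ 0ₘ

  IsNilpotent : Pred → Set (c ⊔ ℓ)
  IsNilpotent J = Σ ℕ λ h → 1 Data.Nat.≤ h × ProdZero J h

  NilpotencyIndex : Pred → ℕ → Set (c ⊔ ℓ)
  NilpotencyIndex J m =
    1 Data.Nat.≤ m × ProdZero J m × (∀ h → 1 Data.Nat.≤ h → h Data.Nat.< m → ¬ ProdZero J h)

{-# OPTIONS --safe #-}
module Submission where

-- T lies in the span of the tensor matrices K h b i = ⊗ₐ Π(hₐ) D(bₐ) Π(iₐ), where in coordinate a the
-- Π are the indicators of {xₐ} and of its complement and D is the identity or the all-ones
-- matrix: they multiply as K h b l · K l′ b′ i = κ · K h (b ∪ b′) i, and every Aⱼ and E*ₕ is a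
-- combination of them.  So E*_g T E*_g is spanned by the K g b g, and B_{g,a,g} = K g a g.
-- Ideal: K g b g · B_{g,a,g} is a multiple of K g (a ∪ b) g = B_{g,(a ∪ b) ∩ g̃,g} (a coordinate
-- with uₐ = 2 has a one-point complement, where identity and all-ones agree), again a generator
-- since kₐ = ∏_{c ∈ a} (u_c − 1).
-- Index: the scalar in K g a g · K g b g is ∏_{c ∈ a ∩ b ∩ g} (u_c − 1).  A generator a meets
-- S = {c ∈ g : u_c ≡ 1} (otherwise kₐ ≠ 0 in the field), so multiplying K g b g by it gives 0
-- if a ∩ S ⊆ b and otherwise enlarges b ∩ S; hence |S| + 1 factors give 0, while the generators
-- B_{g,{y},g}, y ∈ S, multiply without scalar to the nonzero K g S g.

open import Defs
open import Level using (Level; Lift; lift)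
open import Algebra.Bundles using (CommutativeRing)
open import Data.Bool using (Bool; true; false; if_then_else_; _∧_; _∨_; not; _xor_)
import Data.Bool.Properties as B
open import Data.Bool.ListAction using (and)
open import Data.Empty using (⊥-elim)
open import Data.Fin using (Fin; zero; suc; _≟_)
open import Data.Fin.Properties using (any?)
open import Data.Fin.Subset using (Subset; _∈_; _∉_; _⊆_; ∣_∣; _∪_; _∩_; _─_; ⊥; ⊤; ⁅_⁆; Nonempty)
open import Data.Fin.Subset.Properties
  using (_⊆?_; _∈?_; ∈⊤; x∈⁅x⁆; x∈⁅y⁆⇒x≡y; ∣⁅x⁆∣≡1; x∈p∪q⁺; x∈p∪q⁻; x∈p∩q⁺; x∈p∩q⁻;
         p⊆p∪q; q⊆p∪q; p∩q⊆q; p─q⊆p; p─⊥≡p; p⊆q⇒∣p∣≤∣q∣; p⊂q⇒∣p∣<∣q∣; ∣p∩q∣≤∣q∣)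
open import Data.List using (List; []; _∷_; map; concatMap; _++_; foldr; filterᵇ; allFin; length; tabulate)
open import Data.List.Properties using (map-tabulate)
open import Data.Nat using (ℕ; zero; suc; _≤_; _<_; _<ᵇ_; s≤s; z≤n)
import Data.Nat.Properties as ℕ
open import Data.Product using (Σ; _×_; _,_; proj₁; proj₂)
open import Data.Sum using (_⊎_; inj₁; inj₂)
open import Data.Vec as Vec using (Vec; lookup; here; there)
open import Data.Vec.Properties using (lookup-zipWith; lookup-replicate; lookup∘tabulate; []=⇒lookup; lookup⇒[]=)
open import Function.Bundles using (_⇔_; Equivalence)
open import Relation.Binary.Bundles using (Setoid)
open import Relation.Binary.PropositionalEquality as ≡ using (_≡_; _≢_)
import Relation.Binary.Reasoning.Setoid as SetoidReasoning
open import Relation.Nullary using (¬_; ⌊_⌋; does; yes; no)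
open import Relation.Nullary.Decidable using (isYes≗does; _×-dec_; ¬?; decidable-stable)

at-most-two : ∀ {m} {y s t : Fin m} → (2 <ᵇ m) ≡ false → y ≢ s → y ≢ t → s ≡ t
at-most-two {1} {zero}     {zero}     {zero}     _ _   _   = ≡.refl
at-most-two {2} {zero}     {zero}     {_}        _ y≢s _   = ⊥-elim (y≢s ≡.refl)
at-most-two {2} {zero}     {suc zero} {zero}     _ _   y≢t = ⊥-elim (y≢t ≡.refl)
at-most-two {2} {zero}     {suc zero} {suc zero} _ _   _   = ≡.refl
at-most-two {2} {suc zero} {suc zero} {_}        _ y≢s _   = ⊥-elim (y≢s ≡.refl)
at-most-two {2} {suc zero} {zero}     {suc zero} _ _   y≢t = ⊥-elim (y≢t ≡.refl)
at-most-two {2} {suc zero} {zero}     {zero}     _ _   _   = ≡.refl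
at-most-two {suc (suc (suc _))} ()

exactly-two : ∀ {m} → 2 ≤ m → (2 <ᵇ m) ≡ false → m ≡ 2
exactly-two {1}                 (s≤s ()) _
exactly-two {2}                 _ _  = ≡.refl
exactly-two {suc (suc (suc _))} _ ()

another : ∀ {m} → 2 ≤ m → (y : Fin m) → Σ (Fin m) λ s → y ≢ s
another (s≤s (s≤s _)) zero    = suc zero , λ ()
another (s≤s (s≤s _)) (suc _) = zero , λ ()

⊕ˢ-self-⊆? : ∀ {n} (g j : Subset n) → does ((g ⊕ˢ g) ⊆? j) ≡ true
⊕ˢ-self-⊆? Vec.[]         Vec.[]         = ≡.refl
⊕ˢ-self-⊆? (true Vec.∷ g)  (_ Vec.∷ j) = ⊕ˢ-self-⊆? g j
⊕ˢ-self-⊆? (false Vec.∷ g) (_ Vec.∷ j) = ⊕ˢ-self-⊆? g j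

x∉p─⁅x⁆ : ∀ {n} {x : Fin n} (p : Subset n) → x ∉ p ─ ⁅ x ⁆
x∉p─⁅x⁆ {x = zero}  (true  Vec.∷ p) ()
x∉p─⁅x⁆ {x = zero}  (false Vec.∷ p) ()
x∉p─⁅x⁆ {x = suc x} (_     Vec.∷ p) (there x∈p─⁅x⁆) = x∉p─⁅x⁆ p x∈p─⁅x⁆

∣p∣≡1+∣p─⁅x⁆∣ : ∀ {n} {x : Fin n} {p : Subset n} → x ∈ p → ∣ p ∣ ≡ suc ∣ p ─ ⁅ x ⁆ ∣
∣p∣≡1+∣p─⁅x⁆∣ {p = true  Vec.∷ p} here        = ≡.cong (λ q → suc ∣ q ∣) (≡.sym (p─⊥≡p p))
∣p∣≡1+∣p─⁅x⁆∣ {p = true  Vec.∷ p} (there x∈p) = ≡.cong suc (∣p∣≡1+∣p─⁅x⁆∣ x∈p)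
∣p∣≡1+∣p─⁅x⁆∣ {p = false Vec.∷ p} (there x∈p) = ∣p∣≡1+∣p─⁅x⁆∣ x∈p

∣p∣≥1⇒nonempty : ∀ {n} {p : Subset n} → 1 ≤ ∣ p ∣ → Nonempty p
∣p∣≥1⇒nonempty {p = true  Vec.∷ p} _     = zero , here
∣p∣≥1⇒nonempty {p = false Vec.∷ p} 1≤∣p∣ with ∣p∣≥1⇒nonempty 1≤∣p∣
... | x , x∈p = suc x , there x∈p

x∈p⇒∣p∣≥1 : ∀ {n} {x : Fin n} {p : Subset n} → x ∈ p → 1 ≤ ∣ p ∣
x∈p⇒∣p∣≥1 {x = x} {p} x∈p = ≡.subst (_≤ ∣ p ∣) (∣⁅x⁆∣≡1 x) (p⊆q⇒∣p∣≤∣q∣ ⁅x⁆⊆p)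
  where
  ⁅x⁆⊆p : ⁅ x ⁆ ⊆ p
  ⁅x⁆⊆p y∈⁅x⁆ = ≡.subst (_∈ p) (≡.sym (x∈⁅y⁆⇒x≡y x y∈⁅x⁆)) x∈p

∣q∩r∣<∣p∪q∩r∣ : ∀ {n} {p q r : Subset n} {x} → x ∈ p → x ∈ r → x ∉ q → ∣ q ∩ r ∣ < ∣ (p ∪ q) ∩ r ∣
∣q∩r∣<∣p∪q∩r∣ {p = p} {q} {r} x∈p x∈r x∉q =
  p⊂q⇒∣p∣<∣q∣ (q∩r⊆ , _ , x∈p∩q⁺ (x∈p∪q⁺ (inj₁ x∈p) , x∈r) ,
                λ x∈q∩r → x∉q (proj₁ (x∈p∩q⁻ q r x∈q∩r)))
  where
  q∩r⊆ : q ∩ r ⊆ (p ∪ q) ∩ r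
  q∩r⊆ y∈q∩r = x∈p∩q⁺ (x∈p∪q⁺ (inj₂ (proj₁ (x∈p∩q⁻ q r y∈q∩r))) , proj₂ (x∈p∩q⁻ q r y∈q∩r))

module RingSums {c ℓ} (R : CommutativeRing c ℓ) where
  open CommutativeRing R hiding (zero)
  open SetoidReasoning setoid
  open import Algebra.Properties.CommutativeSemigroup +-commutativeSemigroup
    using () renaming (interchange to +-interchange)
  open import Algebra.Properties.Semiring.Sum semiring public
    using (sum; sum-syntax; sum-cong-≋; *-distribˡ-sum; ∑-distrib-+; sum-replicate-zero)
  open import Algebra.Properties.CommutativeMonoid.Sum *-commutativeMonoid public
    using () renaming (sum to product; sum-cong-≋ to product-cong-≋; ∑-distrib-+ to product-distrib;
                       sum-replicate-zero to product-replicate-one)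

  ∏-syntax : ∀ m → (Fin m → Carrier) → Carrier
  ∏-syntax _ = product

  infixl 10 ∏-syntax
  syntax ∏-syntax m (λ i → e) = ∏[ i < m ] e

  ∑-cong : ∀ m {f g : Fin m → Carrier} → (∀ i → f i ≈ g i) → ∑[ i < m ] f i ≈ ∑[ i < m ] g i
  ∑-cong m = sum-cong-≋ {m}

  *-distribˡ-∑ : ∀ m k (f : Fin m → Carrier) → k * ∑[ i < m ] f i ≈ ∑[ i < m ] (k * f i)
  *-distribˡ-∑ m = *-distribˡ-sum {m}

  ∑-≈0 : ∀ m {f : Fin m → Carrier} → (∀ i → f i ≈ 0#) → ∑[ i < m ] f i ≈ 0#
  ∑-≈0 m f≈0 = trans (∑-cong m f≈0) (sum-replicate-zero m)

  ∏-cong : ∀ m {f g : Fin m → Carrier} → (∀ i → f i ≈ g i) → ∏[ i < m ] f i ≈ ∏[ i < m ] g i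
  ∏-cong m = product-cong-≋ {m}

  ∏-distrib-* : ∀ m (f g : Fin m → Carrier) → ∏[ i < m ] (f i * g i) ≈ ∏[ i < m ] f i * ∏[ i < m ] g i
  ∏-distrib-* m = product-distrib {m}

  ∏-≈1 : ∀ m {f : Fin m → Carrier} → (∀ i → f i ≈ 1#) → ∏[ i < m ] f i ≈ 1#
  ∏-≈1 m f≈1 = trans (∏-cong m f≈1) (product-replicate-one m)

  ∏-≈0 : ∀ m {f : Fin m → Carrier} (i : Fin m) → f i ≈ 0# → ∏[ i < m ] f i ≈ 0#
  ∏-≈0 (suc m) zero    fi≈0 = trans (*-congʳ fi≈0) (zeroˡ _)
  ∏-≈0 (suc m) (suc i) fi≈0 = trans (*-congˡ (∏-≈0 m i fi≈0)) (zeroʳ _)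

  ∏-units≉0 : 1# ≉ 0# → ∀ m (f : Fin m → Carrier) → (∀ i → Σ Carrier λ y → f i * y ≈ 1#) → ∏[ i < m ] f i ≉ 0#
  ∏-units≉0 1≉0 zero    f units = 1≉0
  ∏-units≉0 1≉0 (suc m) f units ∏≈0 = ∏-units≉0 1≉0 m (λ i → f (suc i)) (λ i → units (suc i)) (begin
    ∏′                       ≈⟨ sym (*-identityˡ _) ⟩
    1# * ∏′                  ≈⟨ *-congʳ (sym (trans (*-comm _ _) f₀y≈1)) ⟩
    (y * f zero) * ∏′        ≈⟨ *-assoc _ _ _ ⟩
    y * (f zero * ∏′)        ≈⟨ *-congˡ ∏≈0 ⟩
    y * 0#                   ≈⟨ zeroʳ _ ⟩
    0#                       ∎)
    where
    ∏′ = ∏[ i < m ] f (suc i)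
    y = proj₁ (units zero)
    f₀y≈1 = proj₂ (units zero)

  ∑𝔹 : (Bool → Carrier) → Carrier
  ∑𝔹 f = f false + f true

  ⟦_⟧ : Bool → Carrier
  ⟦ b ⟧ = if b then 1# else 0#

  ⟦∧⟧ : ∀ a b → ⟦ a ∧ b ⟧ ≈ ⟦ a ⟧ * ⟦ b ⟧
  ⟦∧⟧ true  b = sym (*-identityˡ _)
  ⟦∧⟧ false b = sym (zeroˡ _)

  ⟦and-tabulate⟧ : ∀ m (p : Fin m → Bool) → ⟦ and (tabulate p) ⟧ ≈ ∏[ i < m ] ⟦ p i ⟧
  ⟦and-tabulate⟧ zero    p = refl
  ⟦and-tabulate⟧ (suc m) p = trans (⟦∧⟧ (p zero) _) (*-congˡ (⟦and-tabulate⟧ m (λ i → p (suc i))))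

  ⟦and⟧ : ∀ m (p : Fin m → Bool) → ⟦ and (map p (allFin m)) ⟧ ≈ ∏[ i < m ] ⟦ p i ⟧
  ⟦and⟧ m p rewrite map-tabulate (λ i → i) p = ⟦and-tabulate⟧ m p

  ⟦⊆?⟧ : ∀ {m} (j a : Subset m) → ⟦ does (j ⊆? a) ⟧ ≈ ∏[ c < m ] ⟦ not (lookup j c) ∨ lookup a c ⟧
  ⟦⊆?⟧ Vec.[]           Vec.[]           = refl
  ⟦⊆?⟧ (false Vec.∷ j) (_ Vec.∷ a)      = trans (⟦⊆?⟧ j a) (sym (*-identityˡ _))
  ⟦⊆?⟧ (true Vec.∷ j)  (false Vec.∷ a)  = sym (zeroˡ _)
  ⟦⊆?⟧ (true Vec.∷ j)  (true Vec.∷ a)   = trans (⟦⊆?⟧ j a) (sym (*-identityˡ _))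

  ⟦b⟧+⟦¬b⟧ : ∀ b → ⟦ b ⟧ + ⟦ not b ⟧ ≈ 1#
  ⟦b⟧+⟦¬b⟧ true  = +-identityʳ _
  ⟦b⟧+⟦¬b⟧ false = +-identityˡ _

  δ : ∀ {m} → Fin m → Fin m → Carrier
  δ s t = ⟦ does (s ≟ t) ⟧

  δᵇ : Bool → Bool → Carrier
  δᵇ e e′ = ⟦ does (e B.≟ e′) ⟧

  ∑-δˡ : ∀ m (s : Fin m) (f : Fin m → Carrier) → ∑[ z < m ] (δ s z * f z) ≈ f s
  ∑-δˡ (suc m) zero f = begin
    1# * f zero + ∑[ i < m ] (0# * f (suc i)) ≈⟨ +-cong (*-identityˡ _) (∑-≈0 m (λ i → zeroˡ _)) ⟩
    f zero + 0#                               ≈⟨ +-identityʳ _ ⟩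
    f zero                                    ∎
  ∑-δˡ (suc m) (suc s) f = begin
    0# * f zero + ∑[ i < m ] (δ s i * f (suc i)) ≈⟨ +-cong (zeroˡ _) (∑-δˡ m s (λ i → f (suc i))) ⟩
    0# + f (suc s)                                     ≈⟨ +-identityˡ _ ⟩
    f (suc s)                                          ∎

  ∑-δʳ : ∀ m (t : Fin m) (f : Fin m → Carrier) → ∑[ z < m ] (f z * δ z t) ≈ f t
  ∑-δʳ (suc m) zero f = begin
    f zero * 1# + ∑[ i < m ] (f (suc i) * 0#) ≈⟨ +-cong (*-identityʳ _) (∑-≈0 m (λ i → zeroʳ _)) ⟩
    f zero + 0#                               ≈⟨ +-identityʳ _ ⟩
    f zero                                    ∎
  ∑-δʳ (suc m) (suc t) f = begin
    f zero * 0# + ∑[ i < m ] (f (suc i) * δ i t) ≈⟨ +-cong (zeroʳ _) (∑-δʳ m t (λ i → f (suc i))) ⟩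
    0# + f (suc t)                                     ≈⟨ +-identityˡ _ ⟩
    f (suc t)                                          ∎

  sumF : ∀ {A : Set} → List A → (A → Carrier) → Carrier
  sumF xs f = foldr (λ a r → f a + r) 0# xs

  sumF-cong : ∀ {A : Set} (xs : List A) {f g : A → Carrier} → (∀ a → f a ≈ g a) → sumF xs f ≈ sumF xs g
  sumF-cong []       f≈g = refl
  sumF-cong (a ∷ xs) f≈g = +-cong (f≈g a) (sumF-cong xs f≈g)

  sumF-≈0 : ∀ {A : Set} (xs : List A) {f : A → Carrier} → (∀ a → f a ≈ 0#) → sumF xs f ≈ 0#
  sumF-≈0 []       f≈0 = refl
  sumF-≈0 (a ∷ xs) f≈0 = trans (+-cong (f≈0 a) (sumF-≈0 xs f≈0)) (+-identityˡ 0#)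

  sumF-distrib-+ : ∀ {A : Set} (xs : List A) (f g : A → Carrier) → sumF xs (λ a → f a + g a) ≈ sumF xs f + sumF xs g
  sumF-distrib-+ []       f g = sym (+-identityˡ 0#)
  sumF-distrib-+ (a ∷ xs) f g = trans (+-congˡ (sumF-distrib-+ xs f g)) (+-interchange (f a) (g a) _ _)

  *-distribˡ-sumF : ∀ {A : Set} (xs : List A) k (f : A → Carrier) → k * sumF xs f ≈ sumF xs (λ a → k * f a)
  *-distribˡ-sumF []       k f = zeroʳ k
  *-distribˡ-sumF (a ∷ xs) k f = trans (distribˡ k _ _) (+-congˡ (*-distribˡ-sumF xs k f))

  *-distribʳ-sumF : ∀ {A : Set} (xs : List A) k (f : A → Carrier) → sumF xs f * k ≈ sumF xs (λ a → f a * k)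
  *-distribʳ-sumF []       k f = zeroˡ k
  *-distribʳ-sumF (a ∷ xs) k f = trans (distribʳ k _ _) (+-congˡ (*-distribʳ-sumF xs k f))

  sumF-++ : ∀ {A : Set} (xs ys : List A) (f : A → Carrier) → sumF (xs ++ ys) f ≈ sumF xs f + sumF ys f
  sumF-++ []       ys f = sym (+-identityˡ _)
  sumF-++ (a ∷ xs) ys f = trans (+-congˡ (sumF-++ xs ys f)) (sym (+-assoc _ _ _))

  sumF-map : ∀ {A B : Set} (h : A → B) (xs : List A) (f : B → Carrier) → sumF (map h xs) f ≡ sumF xs (λ a → f (h a))
  sumF-map h []       f = ≡.refl
  sumF-map h (a ∷ xs) f = ≡.cong (f (h a) +_) (sumF-map h xs f)

  sumF-concatMap : ∀ {A B : Set} (h : A → List B) (xs : List A) (f : B → Carrier) →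
                   sumF (concatMap h xs) f ≈ sumF xs (λ a → sumF (h a) f)
  sumF-concatMap h []       f = refl
  sumF-concatMap h (a ∷ xs) f = trans (sumF-++ (h a) (concatMap h xs) f) (+-congˡ (sumF-concatMap h xs f))

  sumF-filterᵇ : ∀ {A : Set} (p : A → Bool) (xs : List A) (f : A → Carrier) →
                 sumF (filterᵇ p xs) f ≈ sumF xs (λ a → ⟦ p a ⟧ * f a)
  sumF-filterᵇ p []       f = refl
  sumF-filterᵇ p (a ∷ xs) f with p a
  ... | true  = +-cong (sym (*-identityˡ _)) (sumF-filterᵇ p xs f)
  ... | false = trans (sumF-filterᵇ p xs f) (sym (trans (+-congʳ (zeroˡ _)) (+-identityˡ _)))

  sumF-tabulate : ∀ {A : Set} m (h : Fin m → A) (f : A → Carrier) → sumF (tabulate h) f ≡ ∑[ i < m ] f (h i)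
  sumF-tabulate zero    h f = ≡.refl
  sumF-tabulate (suc m) h f = ≡.cong (f (h zero) +_) (sumF-tabulate m (λ i → h (suc i)) f)

  sumF-allPt-∏ : ∀ n (u : Fin n → ℕ) (G : (a : Fin n) → Fin (u a) → Carrier) →
                 sumF (allPt n u) (λ z → ∏[ a < n ] G a (z a)) ≈ ∏[ a < n ] ∑[ s < u a ] G a s
  sumF-allPt-∏ zero    u G = +-identityʳ 1#
  sumF-allPt-∏ (suc n) u G = begin
    sumF (allPt (suc n) u) H
      ≈⟨ sumF-concatMap _ (allFin (u zero)) H ⟩
    sumF (allFin (u zero)) (λ i → sumF (map (consPt {u = u} i) (allPt n u′)) H)
      ≈⟨ sumF-cong (allFin (u zero)) (λ i → reflexive (sumF-map (consPt {u = u} i) (allPt n u′) H)) ⟩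
    sumF (allFin (u zero)) (λ i → sumF (allPt n u′) (λ t → G zero i * ∏[ a < n ] G (suc a) (t a)))
      ≈⟨ sumF-cong (allFin (u zero)) (λ i → sym (*-distribˡ-sumF (allPt n u′) (G zero i) _)) ⟩
    sumF (allFin (u zero)) (λ i → G zero i * sumF (allPt n u′) (λ t → ∏[ a < n ] G (suc a) (t a)))
      ≈⟨ sumF-cong (allFin (u zero)) (λ i → *-congˡ (sumF-allPt-∏ n u′ (λ a → G (suc a)))) ⟩
    sumF (allFin (u zero)) (λ i → G zero i * Q)
      ≈⟨ sym (*-distribʳ-sumF (allFin (u zero)) Q (G zero)) ⟩
    sumF (allFin (u zero)) (G zero) * Q
      ≡⟨ ≡.cong (_* Q) (sumF-tabulate (u zero) (λ i → i) (G zero)) ⟩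
    ∑[ s < u zero ] G zero s * Q ∎
    where
    u′ : Fin n → ℕ
    u′ a = u (suc a)
    H : Pt (suc n) u → Carrier
    H z = ∏[ a < suc n ] G a (z a)
    Q : Carrier
    Q = ∏[ a < n ] ∑[ s < u′ a ] G (suc a) s

  sumF-allSubsets-∏ : ∀ n (G : Fin n → Bool → Carrier) →
                      sumF (allSubsets n) (λ H → ∏[ a < n ] G a (lookup H a)) ≈ ∏[ a < n ] ∑𝔹 (G a)
  sumF-allSubsets-∏ zero    G = +-identityʳ 1#
  sumF-allSubsets-∏ (suc n) G = begin
    sumF (map (false Vec.∷_) S ++ map (true Vec.∷_) S) H
      ≈⟨ sumF-++ (map (false Vec.∷_) S) _ H ⟩
    sumF (map (false Vec.∷_) S) H + sumF (map (true Vec.∷_) S) H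
      ≡⟨ ≡.cong₂ _+_ (sumF-map _ S H) (sumF-map _ S H) ⟩
    sumF S (λ H′ → G zero false * Q H′) + sumF S (λ H′ → G zero true * Q H′)
      ≈⟨ sym (+-cong (*-distribˡ-sumF S _ Q) (*-distribˡ-sumF S _ Q)) ⟩
    G zero false * sumF S Q + G zero true * sumF S Q
      ≈⟨ sym (distribʳ _ _ _) ⟩
    (G zero false + G zero true) * sumF S Q
      ≈⟨ *-congˡ (sumF-allSubsets-∏ n (λ a → G (suc a))) ⟩
    (G zero false + G zero true) * ∏[ a < n ] (G (suc a) false + G (suc a) true) ∎
    where
    S = allSubsets n
    H : Subset (suc n) → Carrier
    H H′ = ∏[ a < suc n ] G a (lookup H′ a)
    Q : Subset n → Carrier
    Q H′ = ∏[ a < n ] G (suc a) (lookup H′ a)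

-- One coordinate with base point xc: Adj false and Adj true are the adjacency matrices of
-- equality and inequality, Π false and Π true are the indicators of {xc} and of its complement,
-- D false and D true are the identity and the all-ones matrix, and L h b i = Π h · D b · Π i.
module CoordinateAlgebra {c ℓ} (R : CommutativeRing c ℓ) {m : ℕ} (xc : Fin m) where
  open CommutativeRing R hiding (zero)
  open RingSums R
  open SetoidReasoning setoid
  open import Algebra.Properties.CommutativeSemigroup *-commutativeSemigroup
    using (interchange; x∙yz≈y∙xz; xy∙z≈xz∙y)
  open import Algebra.Solver.Ring.NaturalCoefficients.Default commutativeSemiring using (solve; _:*_; _:+_; _:=_)
  open import Algebra.Properties.Ring ring using (-0#≈0#)

  Adj : Bool → Fin m → Fin m → Carrier
  Adj false s t = δ s t
  Adj true  s t = ⟦ not (does (s ≟ t)) ⟧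

  Π : Bool → Fin m → Carrier
  Π h = Adj h xc

  D : Bool → Fin m → Fin m → Carrier
  D false s t = δ s t
  D true  s t = 1#

  L : Bool → Bool → Bool → Fin m → Fin m → Carrier
  L h b i s t = Π h s * D b s t * Π i t

  size : Bool → Carrier
  size false = 1#
  size true  = ∑[ s < m ] Π true s

  ∑-Π : ∀ l → ∑[ s < m ] Π l s ≈ size l
  ∑-Π false = trans (∑-cong m (λ s → sym (*-identityʳ _))) (∑-δˡ m xc (λ _ → 1#))
  ∑-Π true  = refl

  Π-* : ∀ l l′ s → Π l s * Π l′ s ≈ δᵇ l l′ * Π l s
  Π-* false false s with does (xc ≟ s)
  ... | true  = refl
  ... | false = trans (zeroˡ _) (sym (zeroʳ _))
  Π-* true  true  s with does (xc ≟ s)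
  ... | true  = trans (zeroˡ _) (sym (zeroʳ _))
  ... | false = refl
  Π-* false true  s with does (xc ≟ s)
  ... | true  = trans (zeroʳ _) (sym (zeroˡ _))
  ... | false = trans (zeroˡ _) (sym (zeroˡ _))
  Π-* true  false s with does (xc ≟ s)
  ... | true  = trans (zeroˡ _) (sym (zeroˡ _))
  ... | false = trans (zeroʳ _) (sym (zeroˡ _))

  L-coeff : Bool → Bool → Bool → Bool → Bool → Carrier
  L-coeff false false h l i = δᵇ h l
  L-coeff true  false h l i = δᵇ i l
  L-coeff false true  h l i = δᵇ h l
  L-coeff true  true  h l i = size l

  private
    ∑-middle : ∀ h l i b b′ s t →
               (Π h s * Π i t) * ∑[ z < m ] (Π l z * (D b s z * D b′ z t)) ≈ L-coeff b b′ h l i * L h (b ∨ b′) i s t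
    ∑-middle h l i false false s t = begin
      (Π h s * Π i t) * ∑[ z < m ] (Π l z * (δ s z * δ z t))
        ≈⟨ *-congˡ (trans (∑-cong m (λ z → x∙yz≈y∙xz _ _ _)) (∑-δˡ m s _)) ⟩
      (Π h s * Π i t) * (Π l s * δ s t)     ≈⟨ interchange _ _ _ _ ⟩
      (Π h s * Π l s) * (Π i t * δ s t)     ≈⟨ *-congʳ (Π-* h l s) ⟩
      (δᵇ h l * Π h s) * (Π i t * δ s t) ≈⟨ *-assoc _ _ _ ⟩
      δᵇ h l * (Π h s * (Π i t * δ s t)) ≈⟨ *-congˡ (trans (*-congˡ (*-comm _ _)) (sym (*-assoc _ _ _))) ⟩
      δᵇ h l * L h false i s t ∎
    ∑-middle h l i true false s t = begin
      (Π h s * Π i t) * ∑[ z < m ] (Π l z * (1# * δ z t))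
        ≈⟨ *-congˡ (trans (∑-cong m (λ z → *-congˡ (*-identityˡ _))) (∑-δʳ m t _)) ⟩
      (Π h s * Π i t) * Π l t               ≈⟨ *-assoc _ _ _ ⟩
      Π h s * (Π i t * Π l t)               ≈⟨ *-congˡ (Π-* i l t) ⟩
      Π h s * (δᵇ i l * Π i t)  ≈⟨ x∙yz≈y∙xz _ _ _ ⟩
      δᵇ i l * (Π h s * Π i t) ≈⟨ *-congˡ (*-congʳ (sym (*-identityʳ _))) ⟩
      δᵇ i l * L h true i s t  ∎
    ∑-middle h l i false true s t = begin
      (Π h s * Π i t) * ∑[ z < m ] (Π l z * (δ s z * 1#))
        ≈⟨ *-congˡ (trans (∑-cong m (λ z → trans (*-congˡ (*-identityʳ _)) (*-comm _ _))) (∑-δˡ m s _)) ⟩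
      (Π h s * Π i t) * Π l s               ≈⟨ xy∙z≈xz∙y _ _ _ ⟩
      (Π h s * Π l s) * Π i t               ≈⟨ *-congʳ (Π-* h l s) ⟩
      (δᵇ h l * Π h s) * Π i t  ≈⟨ *-assoc _ _ _ ⟩
      δᵇ h l * (Π h s * Π i t)  ≈⟨ *-congˡ (*-congʳ (sym (*-identityʳ _))) ⟩
      δᵇ h l * L h true i s t   ∎
    ∑-middle h l i true true s t = begin
      (Π h s * Π i t) * ∑[ z < m ] (Π l z * (1# * 1#))
        ≈⟨ *-congˡ (trans (∑-cong m (λ z → trans (*-congˡ (*-identityˡ 1#)) (*-identityʳ _))) (∑-Π l)) ⟩
      (Π h s * Π i t) * size l  ≈⟨ *-comm _ _ ⟩
      size l * (Π h s * Π i t)  ≈⟨ *-congˡ (*-congʳ (sym (*-identityʳ _))) ⟩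
      size l * L h true i s t   ∎

  L-⋆ : ∀ h b l l′ b′ i s t →
        ∑[ z < m ] (L h b l s z * L l′ b′ i z t) ≈ (δᵇ l l′ * L-coeff b b′ h l i) * L h (b ∨ b′) i s t
  L-⋆ h b l l′ b′ i s t = begin
    ∑[ z < m ] (L h b l s z * L l′ b′ i z t)
      ≈⟨ ∑-cong m (λ z → regroup (Π h s) (D b s z) (Π l z) (Π l′ z) (D b′ z t) (Π i t)) ⟩
    ∑[ z < m ] ((Π h s * Π i t) * ((Π l z * Π l′ z) * (D b s z * D b′ z t)))
      ≈⟨ ∑-cong m (λ z → *-congˡ (trans (*-congʳ (Π-* l l′ z)) (*-assoc _ _ _))) ⟩
    ∑[ z < m ] ((Π h s * Π i t) * (δᵇ l l′ * (Π l z * (D b s z * D b′ z t))))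
      ≈⟨ sym (trans (*-congˡ (*-distribˡ-∑ m _ _)) (*-distribˡ-∑ m _ _)) ⟩
    (Π h s * Π i t) * (δᵇ l l′ * ∑[ z < m ] (Π l z * (D b s z * D b′ z t)))
      ≈⟨ x∙yz≈y∙xz _ _ _ ⟩
    δᵇ l l′ * ((Π h s * Π i t) * ∑[ z < m ] (Π l z * (D b s z * D b′ z t)))
      ≈⟨ *-congˡ (∑-middle h l i b b′ s t) ⟩
    δᵇ l l′ * (L-coeff b b′ h l i * L h (b ∨ b′) i s t)
      ≈⟨ sym (*-assoc _ _ _) ⟩
    (δᵇ l l′ * L-coeff b b′ h l i) * L h (b ∨ b′) i s t ∎
    where
    regroup : ∀ p d q q′ d′ r → (p * d * q) * (q′ * d′ * r) ≈ (p * r) * ((q * q′) * (d * d′))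
    regroup = solve 6 (λ p d q q′ d′ r → (p :* d :* q) :* (q′ :* d′ :* r) := (p :* r) :* ((q :* q′) :* (d :* d′))) refl

  Π-idem : ∀ h s → Π h s * Π h s ≈ Π h s
  Π-idem false s = trans (Π-* false false s) (*-identityˡ _)
  Π-idem true  s = trans (Π-* true true s) (*-identityˡ _)

  δ-refl : ∀ (s : Fin m) → δ s s ≈ 1#
  δ-refl s with s ≟ s
  ... | yes _  = refl
  ... | no s≢s = ⊥-elim (s≢s ≡.refl)

  ⟦⌊≟⌋⟧ : ∀ (s t : Fin m) → ⟦ ⌊ s ≟ t ⌋ ⟧ ≈ δ s t
  ⟦⌊≟⌋⟧ s t = reflexive (≡.cong ⟦_⟧ (isYes≗does (s ≟ t)))

  ⟦⌊≟⌋-xor⟧ : ∀ b (s t : Fin m) → ⟦ not (not ⌊ s ≟ t ⌋ xor b) ⟧ ≈ Adj b s t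
  ⟦⌊≟⌋-xor⟧ false s t with s ≟ t
  ... | yes _ = refl
  ... | no _  = refl
  ⟦⌊≟⌋-xor⟧ true  s t with s ≟ t
  ... | yes _ = refl
  ... | no _  = refl

  δ-Π : ∀ G (s t : Fin m) → δ s t * Π G s ≈ L G false G s t
  δ-Π G s t with s ≟ t
  ... | yes ≡.refl = trans (*-identityˡ _) (sym (trans (*-congʳ (*-identityʳ _)) (Π-idem G s)))
  ... | no _       = trans (zeroˡ _) (sym (trans (*-congʳ (zeroʳ _)) (zeroˡ _)))

  Π-Adj-Π : ∀ G J s t → ∑[ z < m ] (∑[ y < m ] (L G false G s y * Adj J y z) * L G false G z t) ≈ Π G s * Adj J s t * Π G t
  Π-Adj-Π G J s t = begin
    ∑[ z < m ] (∑[ y < m ] ((Π G s * δ s y * Π G y) * Adj J y z) * (Π G z * δ z t * Π G t))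
      ≈⟨ ∑-cong m (λ z → *-congʳ (trans (∑-cong m (λ y → pull-δˡ _ _ _ _)) (∑-δˡ m s _))) ⟩
    ∑[ z < m ] (((Π G s * Π G s) * Adj J s z) * (Π G z * δ z t * Π G t))
      ≈⟨ ∑-cong m (λ z → trans (*-congʳ (*-congʳ (Π-idem G s))) (pull-δʳ _ _ _ _)) ⟩
    ∑[ z < m ] (((Π G s * Adj J s z) * (Π G z * Π G t)) * δ z t)
      ≈⟨ ∑-δʳ m t _ ⟩
    (Π G s * Adj J s t) * (Π G t * Π G t) ≈⟨ *-congˡ (Π-idem G t) ⟩
    Π G s * Adj J s t * Π G t ∎
    where
    pull-δˡ : ∀ p d q r → (p * d * q) * r ≈ d * ((p * q) * r)
    pull-δˡ = solve 4 (λ p d q r → (p :* d :* q) :* r := d :* ((p :* q) :* r)) refl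
    pull-δʳ : ∀ r p d q → r * (p * d * q) ≈ (r * (p * q)) * d
    pull-δʳ = solve 4 (λ r p d q → r :* (p :* d :* q) := (r :* (p :* q)) :* d) refl

  size-true+1 : size true + 1# ≈ ∑[ s < m ] 1#
  size-true+1 = begin
    size true + 1#                              ≈⟨ +-congˡ (sym (∑-Π false)) ⟩
    ∑[ s < m ] Π true s + ∑[ s < m ] Π false s  ≈⟨ sym (∑-distrib-+ (Π true) (Π false)) ⟩
    ∑[ s < m ] (Π true s + Π false s)           ≈⟨ ∑-cong m (λ s → trans (+-comm _ _) (⟦b⟧+⟦¬b⟧ _)) ⟩
    ∑[ s < m ] 1#                               ∎

  L-coeff-diag : ∀ G a b → δᵇ G G * L-coeff a b G G G ≈ (if a ∧ b then size G else 1#)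
  L-coeff-diag false false false = *-identityˡ _
  L-coeff-diag false false true  = *-identityˡ _
  L-coeff-diag false true  false = *-identityˡ _
  L-coeff-diag false true  true  = *-identityˡ _
  L-coeff-diag true  false false = *-identityˡ _
  L-coeff-diag true  false true  = *-identityˡ _
  L-coeff-diag true  true  false = *-identityˡ _
  L-coeff-diag true  true  true  = *-identityˡ _

  ∑-L : ∀ b s t → ∑𝔹 (λ h → ∑𝔹 (λ i → L h b i s t)) ≈ D b s t
  ∑-L b s t = begin
    ∑𝔹 (λ h → ∑𝔹 (λ i → L h b i s t))
      ≈⟨ factorise (Π false s) (Π true s) (D b s t) (Π false t) (Π true t) ⟩
    (Π false s + Π true s) * D b s t * (Π false t + Π true t)
      ≈⟨ *-cong (*-congʳ (⟦b⟧+⟦¬b⟧ _)) (⟦b⟧+⟦¬b⟧ _) ⟩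
    1# * D b s t * 1#
      ≈⟨ trans (*-identityʳ _) (*-identityˡ _) ⟩
    D b s t ∎
    where
    factorise : ∀ p p′ d q q′ → (p * d * q + p * d * q′) + (p′ * d * q + p′ * d * q′) ≈ (p + p′) * d * (q + q′)
    factorise = solve 5 (λ p p′ d q q′ → (p :* d :* q :+ p :* d :* q′) :+ (p′ :* d :* q :+ p′ :* d :* q′)
                                          := (p :+ p′) :* d :* (q :+ q′)) refl

  Adj-coeff : Bool → Bool → Carrier
  Adj-coeff j false = - ⟦ j ⟧
  Adj-coeff j true  = 1#

  ∑-Adj-coeff-D : ∀ j s t → ∑𝔹 (λ b → Adj-coeff j b * D (j ∧ b) s t) ≈ Adj j s t
  ∑-Adj-coeff-D false s t = trans (+-cong (trans (*-congʳ -0#≈0#) (zeroˡ _)) (*-identityˡ _)) (+-identityˡ _)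
  ∑-Adj-coeff-D true  s t with does (s ≟ t)
  ... | true  = trans (+-cong (*-identityʳ _) (*-identityʳ _)) (-‿inverseˡ 1#)
  ... | false = trans (+-cong (zeroʳ _) (*-identityʳ _)) (+-identityˡ _)

  Adj-as-∑L : ∀ j s t → ∑𝔹 (λ b → ∑𝔹 (λ h → ∑𝔹 (λ i → Adj-coeff j b * L h (j ∧ b) i s t))) ≈ Adj j s t
  Adj-as-∑L j s t = trans (+-cong (pull false) (pull true)) (∑-Adj-coeff-D j s t)
    where
    pull : ∀ b → ∑𝔹 (λ h → ∑𝔹 (λ i → Adj-coeff j b * L h (j ∧ b) i s t)) ≈ Adj-coeff j b * D (j ∧ b) s t
    pull b = trans (sym (trans (distribˡ _ _ _) (+-cong (distribˡ _ _ _) (distribˡ _ _ _))))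
                   (*-congˡ (∑-L (j ∧ b) s t))

  L-as-∑Adj : ∀ G b s t → ∑𝔹 (λ e → ⟦ not e ∨ b ⟧ * (Π G s * Adj e s t * Π G t)) ≈ L G b G s t
  L-as-∑Adj G false s t = trans (+-cong (*-identityˡ _) (zeroˡ _)) (+-identityʳ _)
  L-as-∑Adj G true  s t = begin
    1# * (Π G s * δ s t * Π G t) + 1# * (Π G s * ⟦ not (does (s ≟ t)) ⟧ * Π G t)
      ≈⟨ +-cong (*-identityˡ _) (*-identityˡ _) ⟩
    Π G s * δ s t * Π G t + Π G s * ⟦ not (does (s ≟ t)) ⟧ * Π G t
      ≈⟨ sym (trans (*-congʳ (distribˡ _ _ _)) (distribʳ _ _ _)) ⟩
    Π G s * (δ s t + ⟦ not (does (s ≟ t)) ⟧) * Π G t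
      ≈⟨ *-congʳ (*-congˡ (⟦b⟧+⟦¬b⟧ _)) ⟩
    Π G s * 1# * Π G t ∎

  private
    zero-left : ∀ {d d′ q} → 0# * d * q ≈ 0# * d′ * q
    zero-left = trans (*-congʳ (zeroˡ _)) (trans (zeroˡ _) (sym (trans (*-congʳ (zeroˡ _)) (zeroˡ _))))

    zero-right : ∀ {p d d′} → p * d * 0# ≈ p * d′ * 0#
    zero-right = trans (zeroʳ _) (sym (zeroʳ _))

  -- Π G is supported on one point when G = false, or G = true and m ≤ 2; there D true = D false.
  L-true≈L-false : ∀ G → (G ∧ (2 <ᵇ m)) ≡ false → ∀ s t → L G true G s t ≈ L G false G s t
  L-true≈L-false false _ s t with xc ≟ s | xc ≟ t | s ≟ t
  ... | no _     | _        | _     = zero-left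
  ... | yes _    | no _     | _     = zero-right
  ... | yes _    | yes _    | yes _ = refl
  ... | yes xc≡s | yes xc≡t | no s≢t = ⊥-elim (s≢t (≡.trans (≡.sym xc≡s) xc≡t))
  L-true≈L-false true  m≤2 s t with xc ≟ s | xc ≟ t | s ≟ t
  ... | yes _    | _        | _     = zero-left
  ... | no _     | yes _    | _     = zero-right
  ... | no _     | no _     | yes _ = refl
  ... | no xc≢s  | no xc≢t  | no s≢t = ⊥-elim (s≢t (at-most-two m≤2 xc≢s xc≢t))

  Π-witness : 2 ≤ m → ∀ G → Σ (Fin m) λ s → Π G s ≈ 1#
  Π-witness _ false = xc , δ-refl xc
  Π-witness 2≤m true = proj₁ (another 2≤m xc) , Π-true (proj₂ (another 2≤m xc))
    where
    Π-true : ∀ {s} → xc ≢ s → Π true s ≈ 1#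
    Π-true {s} xc≢s with xc ≟ s
    ... | yes xc≡s = ⊥-elim (xc≢s xc≡s)
    ... | no _     = refl

  L-witness : 2 ≤ m → ∀ G b → Σ (Fin m) λ s → L G b G s s ≈ 1#
  L-witness 2≤m G b = s , trans (*-cong (*-cong Πs≈1 (D-refl b)) Πs≈1) (trans (*-identityʳ _) (*-identityʳ _))
    where
    s = proj₁ (Π-witness 2≤m G)
    Πs≈1 = proj₂ (Π-witness 2≤m G)
    D-refl : ∀ b → D b s s ≈ 1#
    D-refl false = δ-refl s
    D-refl true  = refl

module FactorialScheme {c ℓ} (F : Field c ℓ) (n : ℕ) (u : Fin n → ℕ) (x : Pt n u) where
  open Field F hiding (zero)
  open Setting F n u x
  open RingSums commutativeRing hiding (sumF)
  open SetoidReasoning setoid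
  module Coord (a : Fin n) = CoordinateAlgebra commutativeRing (x a)
  open Coord using (Π; D; L; size; L-coeff)
  open import Algebra.Properties.CommutativeSemigroup *-commutativeSemigroup using (x∙yz≈y∙xz)
  open import Algebra.Properties.Group +-group using () renaming (∙-cancelˡ to +-cancelˡ; ∙-cancelʳ to +-cancelʳ)

  ≈ₘ-setoid : Setoid c ℓ
  ≈ₘ-setoid = record
    { Carrier       = Mat
    ; _≈_           = _≈ₘ_
    ; isEquivalence = record
      { refl  = λ v w → refl
      ; sym   = λ M≈N v w → sym (M≈N v w)
      ; trans = λ M≈N N≈O v w → trans (M≈N v w) (N≈O v w)
      }
    }

  open Setoid ≈ₘ-setoid public using () renaming (refl to ≈ₘ-refl; sym to ≈ₘ-sym; trans to ≈ₘ-trans)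

  *ₘ-cong : ∀ {M M′ N N′} → M ≈ₘ M′ → N ≈ₘ N′ → M *ₘ N ≈ₘ M′ *ₘ N′
  *ₘ-cong M≈M′ N≈N′ v w = sumF-cong allX (λ z → *-cong (M≈M′ v z) (N≈N′ z w))

  +ₘ-cong : ∀ {M M′ N N′} → M ≈ₘ M′ → N ≈ₘ N′ → M +ₘ N ≈ₘ M′ +ₘ N′
  +ₘ-cong M≈M′ N≈N′ v w = +-cong (M≈M′ v w) (N≈N′ v w)

  •-congˡ : ∀ {k M M′} → M ≈ₘ M′ → k • M ≈ₘ k • M′
  •-congˡ M≈M′ v w = *-congˡ (M≈M′ v w)

  •-congʳ : ∀ {k k′} M → k ≈ k′ → k • M ≈ₘ k′ • M
  •-congʳ M k≈k′ v w = *-congʳ k≈k′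

  *ₘ-zeroˡ : ∀ N → 0ₘ *ₘ N ≈ₘ 0ₘ
  *ₘ-zeroˡ N v w = sumF-≈0 allX (λ z → zeroˡ _)

  *ₘ-zeroʳ : ∀ M → M *ₘ 0ₘ ≈ₘ 0ₘ
  *ₘ-zeroʳ M v w = sumF-≈0 allX (λ z → zeroʳ _)

  *ₘ-distribʳ-+ₘ : ∀ M M′ N → (M +ₘ M′) *ₘ N ≈ₘ M *ₘ N +ₘ M′ *ₘ N
  *ₘ-distribʳ-+ₘ M M′ N v w = trans (sumF-cong allX (λ z → distribʳ _ _ _)) (sumF-distrib-+ allX _ _)

  *ₘ-distribˡ-+ₘ : ∀ M N N′ → M *ₘ (N +ₘ N′) ≈ₘ M *ₘ N +ₘ M *ₘ N′
  *ₘ-distribˡ-+ₘ M N N′ v w = trans (sumF-cong allX (λ z → distribˡ _ _ _)) (sumF-distrib-+ allX _ _)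

  •-*ₘ : ∀ k M N → (k • M) *ₘ N ≈ₘ k • (M *ₘ N)
  •-*ₘ k M N v w = trans (sumF-cong allX (λ z → *-assoc _ _ _)) (sym (*-distribˡ-sumF allX k _))

  *ₘ-• : ∀ k M N → M *ₘ (k • N) ≈ₘ k • (M *ₘ N)
  *ₘ-• k M N v w = trans (sumF-cong allX (λ z → x∙yz≈y∙xz _ _ _)) (sym (*-distribˡ-sumF allX k _))

  sumₘ-apply : ∀ {A : Set} (xs : List A) (f : A → Mat) v w → sumₘ xs f v w ≡ sumF xs (λ a → f a v w)
  sumₘ-apply []       f v w = ≡.refl
  sumₘ-apply (a ∷ xs) f v w = ≡.cong (f a v w +_) (sumₘ-apply xs f v w)

  Factors : Set c
  Factors = (a : Fin n) → Fin (u a) → Fin (u a) → Carrier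

  Factors𝔹 : Set c
  Factors𝔹 = (a : Fin n) → Bool → Fin (u a) → Fin (u a) → Carrier

  ⊗ : Factors → Mat
  ⊗ ψ v w = ∏[ a < n ] ψ a (v a) (w a)

  ⊗-cong : ∀ {ψ φ : Factors} → (∀ a s t → ψ a s t ≈ φ a s t) → ⊗ ψ ≈ₘ ⊗ φ
  ⊗-cong ψ≈φ v w = ∏-cong n (λ a → ψ≈φ a (v a) (w a))

  _⋆_ : Factors → Factors → Factors
  (ψ ⋆ φ) a s t = ∑[ z < u a ] (ψ a s z * φ a z t)

  ⊗-*ₘ : ∀ ψ φ → ⊗ ψ *ₘ ⊗ φ ≈ₘ ⊗ (ψ ⋆ φ)
  ⊗-*ₘ ψ φ v w = trans (sumF-cong allX (λ z → sym (∏-distrib-* n _ _)))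
                       (sumF-allPt-∏ n u (λ a s → ψ a (v a) s * φ a s (w a)))

  ⊗-scale : ∀ (k : Fin n → Carrier) ψ → ⊗ (λ a s t → k a * ψ a s t) ≈ₘ (∏[ a < n ] k a) • ⊗ ψ
  ⊗-scale k ψ v w = ∏-distrib-* n _ _

  Kᶠ : Subset n → Subset n → Subset n → Factors
  Kᶠ h b i a = L a (lookup h a) (lookup b a) (lookup i a)

  K : Subset n → Subset n → Subset n → Mat
  K h b i = ⊗ (Kᶠ h b i)

  κᶠ : (h b l l′ b′ i : Subset n) → Fin n → Carrier
  κᶠ h b l l′ b′ i a =
    δᵇ (lookup l a) (lookup l′ a) * L-coeff a (lookup b a) (lookup b′ a) (lookup h a) (lookup l a) (lookup i a)

  K-*ₘ : ∀ h b l l′ b′ i → K h b l *ₘ K l′ b′ i ≈ₘ (∏[ a < n ] κᶠ h b l l′ b′ i a) • K h (b ∪ b′) i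
  K-*ₘ h b l l′ b′ i =
    ≈ₘ-trans (⊗-*ₘ (Kᶠ h b l) (Kᶠ l′ b′ i)) (≈ₘ-trans (⊗-cong factor) (⊗-scale _ (Kᶠ h (b ∪ b′) i)))
    where
    factor : ∀ a s t → ∑[ z < u a ] (Kᶠ h b l a s z * Kᶠ l′ b′ i a z t) ≈ κᶠ h b l l′ b′ i a * Kᶠ h (b ∪ b′) i a s t
    factor a s t = trans (Coord.L-⋆ a (lookup h a) (lookup b a) (lookup l a) (lookup l′ a) (lookup b′ a) (lookup i a) s t)
      (*-congˡ (reflexive (≡.cong (λ e → L a (lookup h a) e (lookup i a) s t) (≡.sym (lookup-zipWith _∨_ a b b′)))))

  natF≈∑1 : ∀ m → natF m ≈ ∑[ s < m ] 1#
  natF≈∑1 zero    = refl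
  natF≈∑1 (suc m) = +-congˡ (natF≈∑1 m)

  natF-length-filterᵇ : ∀ {A : Set} (p : A → Bool) (xs : List A) → natF (length (filterᵇ p xs)) ≈ sumF xs (λ a → ⟦ p a ⟧)
  natF-length-filterᵇ p []       = refl
  natF-length-filterᵇ p (a ∷ xs) with p a
  ... | true  = +-congˡ (natF-length-filterᵇ p xs)
  ... | false = trans (natF-length-filterᵇ p xs) (sym (+-identityˡ _))

  A-⊗ : ∀ j → A j ≈ₘ ⊗ (λ a → Coord.Adj a (lookup j a))
  A-⊗ j v w = trans (⟦and⟧ n _) (∏-cong n (λ a → Coord.⟦⌊≟⌋-xor⟧ a (lookup j a) (v a) (w a)))

  1ₘ-⊗ : 1ₘ ≈ₘ ⊗ (λ a → δ)
  1ₘ-⊗ v w = trans (⟦and⟧ n _) (∏-cong n (λ a → Coord.⟦⌊≟⌋⟧ a (v a) (w a)))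

  K-*ₘ-1ₘ : ∀ h b i → K h b i *ₘ 1ₘ ≈ₘ K h b i
  K-*ₘ-1ₘ h b i = ≈ₘ-trans (*ₘ-cong ≈ₘ-refl 1ₘ-⊗)
    (≈ₘ-trans (⊗-*ₘ (Kᶠ h b i) (λ a → δ)) (⊗-cong (λ a s t → ∑-δʳ (u a) t (λ z → Kᶠ h b i a s z))))

  K-⊥ : ∀ h i → K h ⊥ i ≈ₘ ⊗ (λ a → L a (lookup h a) false (lookup i a))
  K-⊥ h i = ⊗-cong (λ a s t → reflexive (≡.cong (λ e → L a (lookup h a) e (lookup i a) s t) (lookup-replicate a false)))

  Eᶠ : Subset n → Factors
  Eᶠ g a = L a (lookup g a) false (lookup g a)

  E*-⊗ : ∀ g → E* g ≈ₘ ⊗ (Eᶠ g)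
  E*-⊗ g v w = begin
    ⟦ eqX v w ∧ inR g x v ⟧                                    ≈⟨ ⟦∧⟧ _ _ ⟩
    ⟦ eqX v w ⟧ * ⟦ inR g x v ⟧                                ≈⟨ *-cong (⟦and⟧ n _) (⟦and⟧ n _) ⟩
    ∏[ a < n ] ⟦ ⌊ v a ≟ w a ⌋ ⟧ * ∏[ a < n ] ⟦ not (not ⌊ x a ≟ v a ⌋ xor lookup g a) ⟧
      ≈⟨ sym (∏-distrib-* n _ _) ⟩
    ∏[ a < n ] (⟦ ⌊ v a ≟ w a ⌋ ⟧ * ⟦ not (not ⌊ x a ≟ v a ⌋ xor lookup g a) ⟧)
      ≈⟨ ∏-cong n (λ a → trans (*-cong (Coord.⟦⌊≟⌋⟧ a (v a) (w a)) (Coord.⟦⌊≟⌋-xor⟧ a (lookup g a) (x a) (v a)))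
                               (Coord.δ-Π a (lookup g a) (v a) (w a))) ⟩
    ⊗ (Eᶠ g) v w ∎

  E*-K : ∀ g → E* g ≈ₘ K g ⊥ g
  E*-K g = ≈ₘ-trans (E*-⊗ g) (≈ₘ-sym (K-⊥ g g))

  E*AE*-⊗ : ∀ g j → E* g *ₘ A j *ₘ E* g
                    ≈ₘ ⊗ (λ a s t → Π a (lookup g a) s * Coord.Adj a (lookup j a) s t * Π a (lookup g a) t)
  E*AE*-⊗ g j = ≈ₘ-trans (*ₘ-cong (*ₘ-cong (E*-⊗ g) (A-⊗ j)) (E*-⊗ g))
               (≈ₘ-trans (*ₘ-cong (⊗-*ₘ (Eᶠ g) Aᶠ) ≈ₘ-refl)
               (≈ₘ-trans (⊗-*ₘ (Eᶠ g ⋆ Aᶠ) (Eᶠ g))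
               (⊗-cong (λ a → Coord.Π-Adj-Π a (lookup g a) (lookup j a)))))
    where
    Aᶠ : Factors
    Aᶠ a = Coord.Adj a (lookup j a)

  B-K : ∀ g a → B g a g ≈ₘ K g a g
  B-K g a v w = begin
    B g a g v w
      ≡⟨ sumₘ-apply (filterᵇ p S) _ v w ⟩
    sumF (filterᵇ p S) (λ j → (E* g *ₘ A j *ₘ E* g) v w)
      ≈⟨ sumF-filterᵇ p S _ ⟩
    sumF S (λ j → ⟦ p j ⟧ * (E* g *ₘ A j *ₘ E* g) v w)
      ≈⟨ sumF-cong S (λ j → *-cong (⟦p⟧ j) (E*AE*-⊗ g j v w)) ⟩
    sumF S (λ j → ∏[ c < n ] ⟦ not (lookup j c) ∨ lookup a c ⟧ * ∏[ c < n ] f c (lookup j c))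
      ≈⟨ sumF-cong S (λ j → sym (∏-distrib-* n _ _)) ⟩
    sumF S (λ j → ∏[ c < n ] (⟦ not (lookup j c) ∨ lookup a c ⟧ * f c (lookup j c)))
      ≈⟨ sumF-allSubsets-∏ n (λ c e → ⟦ not e ∨ lookup a c ⟧ * f c e) ⟩
    ∏[ c < n ] ∑𝔹 (λ e → ⟦ not e ∨ lookup a c ⟧ * f c e)
      ≈⟨ ∏-cong n (λ c → Coord.L-as-∑Adj c (lookup g c) (lookup a c) (v c) (w c)) ⟩
    K g a g v w ∎
    where
    S = allSubsets n
    p : Subset n → Bool
    p j = ⌊ (g ⊕ˢ g) ⊆? j ⌋ ∧ ⌊ j ⊆? a ⌋
    ⟦p⟧ : ∀ j → ⟦ p j ⟧ ≈ ∏[ c < n ] ⟦ not (lookup j c) ∨ lookup a c ⟧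
    ⟦p⟧ j rewrite isYes≗does ((g ⊕ˢ g) ⊆? j) | ⊕ˢ-self-⊆? g j | isYes≗does (j ⊆? a) = ⟦⊆?⟧ j a
    f : (c : Fin n) → Bool → Carrier
    f c e = Π c (lookup g c) (v c) * Coord.Adj c e (v c) (w c) * Π c (lookup g c) (w c)

  natF-k : ∀ a → natF (k a) ≈ ∏[ c < n ] size c (lookup a c)
  natF-k a = begin
    natF (k a)
      ≈⟨ natF-length-filterᵇ (inR a x) allX ⟩
    sumF allX (λ z → ⟦ inR a x z ⟧)
      ≈⟨ sumF-cong allX (λ z → ⟦and⟧ n _) ⟩
    sumF allX (λ z → ∏[ c < n ] ⟦ not (not ⌊ x c ≟ z c ⌋ xor lookup a c) ⟧)
      ≈⟨ sumF-allPt-∏ n u _ ⟩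
    ∏[ c < n ] ∑[ s < u c ] ⟦ not (not ⌊ x c ≟ s ⌋ xor lookup a c) ⟧
      ≈⟨ ∏-cong n (λ c → ∑-cong (u c) (λ s → Coord.⟦⌊≟⌋-xor⟧ c (lookup a c) (x c) s)) ⟩
    ∏[ c < n ] ∑[ s < u c ] Π c (lookup a c) s
      ≈⟨ ∏-cong n (λ c → Coord.∑-Π c (lookup a c)) ⟩
    ∏[ c < n ] size c (lookup a c) ∎

  Span-sumₘ : ∀ {S : Pred} {A : Set} (xs : List A) (f : A → Mat) → (∀ a → Span S (f a)) → Span S (sumₘ xs f)
  Span-sumₘ []       f f∈S = zeroₛ
  Span-sumₘ (a ∷ xs) f f∈S = add (f∈S a) (Span-sumₘ xs f f∈S)

  module _ {S₁ S₂ S₃ : Pred} (gen-*ₘ : ∀ {M N} → S₁ M → S₂ N → Span S₃ (M *ₘ N)) where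

    private
      Span-*ₘʳ : ∀ {M N} → S₁ M → Span S₂ N → Span S₃ (M *ₘ N)
      Span-*ₘʳ {M} M∈S₁ zeroₛ       = resp zeroₛ (≈ₘ-sym (*ₘ-zeroʳ M))
      Span-*ₘʳ     M∈S₁ (gen N∈S₂)  = gen-*ₘ M∈S₁ N∈S₂
      Span-*ₘʳ {M} M∈S₁ (add N N′)  =
        resp (add (Span-*ₘʳ M∈S₁ N) (Span-*ₘʳ M∈S₁ N′)) (≈ₘ-sym (*ₘ-distribˡ-+ₘ M _ _))
      Span-*ₘʳ {M} M∈S₁ (scal k N)  = resp (scal k (Span-*ₘʳ M∈S₁ N)) (≈ₘ-sym (*ₘ-• k M _))
      Span-*ₘʳ     M∈S₁ (resp N N≈) = resp (Span-*ₘʳ M∈S₁ N) (*ₘ-cong ≈ₘ-refl N≈)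

    Span-*ₘ : ∀ {M N} → Span S₁ M → Span S₂ N → Span S₃ (M *ₘ N)
    Span-*ₘ {N = N} zeroₛ        N∈ = resp zeroₛ (≈ₘ-sym (*ₘ-zeroˡ N))
    Span-*ₘ         (gen M∈S₁)   N∈ = Span-*ₘʳ M∈S₁ N∈
    Span-*ₘ {N = N} (add M M′)   N∈ = resp (add (Span-*ₘ M N∈) (Span-*ₘ M′ N∈)) (≈ₘ-sym (*ₘ-distribʳ-+ₘ _ _ N))
    Span-*ₘ {N = N} (scal k M)   N∈ = resp (scal k (Span-*ₘ M N∈)) (≈ₘ-sym (•-*ₘ k _ N))
    Span-*ₘ         (resp M M≈)  N∈ = resp (Span-*ₘ M N∈) (*ₘ-cong M≈ ≈ₘ-refl)

  AnyK : Pred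
  AnyK M = Lift c (Σ (Subset n) λ h → Σ (Subset n) λ b → Σ (Subset n) λ i → M ≈ₘ K h b i)

  RowK : Subset n → Pred
  RowK g M = Lift c (Σ (Subset n) λ b → Σ (Subset n) λ i → M ≈ₘ K g b i)

  DiagK : Subset n → Pred
  DiagK g M = Lift c (Σ (Subset n) λ b → M ≈ₘ K g b g)

  K∈AnyK : ∀ h b i → Span AnyK (K h b i)
  K∈AnyK h b i = gen (lift (h , b , i , ≈ₘ-refl))

  AnyK-*ₘ : ∀ {M N} → AnyK M → AnyK N → Span AnyK (M *ₘ N)
  AnyK-*ₘ (lift (h , b , l , M≈)) (lift (l′ , b′ , i , N≈)) =
    resp (scal _ (K∈AnyK h (b ∪ b′) i)) (≈ₘ-sym (≈ₘ-trans (*ₘ-cong M≈ N≈) (K-*ₘ h b l l′ b′ i)))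

  DiagK-*ₘ-AnyK : ∀ {g M N} → DiagK g M → AnyK N → Span (RowK g) (M *ₘ N)
  DiagK-*ₘ-AnyK {g} (lift (b , M≈)) (lift (h , b′ , i , N≈)) =
    resp (scal _ (gen (lift (b ∪ b′ , i , ≈ₘ-refl)))) (≈ₘ-sym (≈ₘ-trans (*ₘ-cong M≈ N≈) (K-*ₘ g b g h b′ i)))

  RowK-*ₘ-DiagK : ∀ {g M N} → RowK g M → DiagK g N → Span (DiagK g) (M *ₘ N)
  RowK-*ₘ-DiagK {g} (lift (b , i , M≈)) (lift (b′ , N≈)) =
    resp (scal _ (gen (lift (b ∪ b′ , ≈ₘ-refl)))) (≈ₘ-sym (≈ₘ-trans (*ₘ-cong M≈ N≈) (K-*ₘ g b i g b′ g)))

  ⊗-∑𝔹 : ∀ (ψ : Factors𝔹) →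
         ⊗ (λ a s t → ∑𝔹 (λ e → ψ a e s t)) ≈ₘ sumₘ (allSubsets n) (λ H → ⊗ (λ a → ψ a (lookup H a)))
  ⊗-∑𝔹 ψ v w = sym (trans (reflexive (sumₘ-apply (allSubsets n) _ v w)) (sumF-allSubsets-∏ n (λ a e → ψ a e (v a) (w a))))

  Span-⊗-∑𝔹 : ∀ {S} (ψ : Factors𝔹) →
              (∀ H → Span S (⊗ (λ a → ψ a (lookup H a)))) → Span S (⊗ (λ a s t → ∑𝔹 (λ e → ψ a e s t)))
  Span-⊗-∑𝔹 ψ ψ∈S = resp (Span-sumₘ (allSubsets n) _ ψ∈S) (≈ₘ-sym (⊗-∑𝔹 ψ))

  A∈Span : ∀ j → Span AnyK (A j)
  A∈Span j = resp (Span-⊗-∑𝔹 outer λ b → Span-⊗-∑𝔹 (middle b) λ h → Span-⊗-∑𝔹 (inner b h) λ i →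
                    resp (scal _ (K∈AnyK h (j ∩ b) i)) (≈ₘ-sym (inner≈K b h i)))
                  (≈ₘ-sym (≈ₘ-trans (A-⊗ j) (⊗-cong (λ a s t → sym (Coord.Adj-as-∑L a (lookup j a) s t)))))
    where
    coeff : Subset n → Fin n → Carrier
    coeff b a = Coord.Adj-coeff a (lookup j a) (lookup b a)
    inner : Subset n → Subset n → Factors𝔹
    inner b h a e s t = coeff b a * L a (lookup h a) (lookup j a ∧ lookup b a) e s t
    middle : Subset n → Factors𝔹
    middle b a e s t = ∑𝔹 (λ e′ → coeff b a * L a e (lookup j a ∧ lookup b a) e′ s t)
    outer : Factors𝔹
    outer a e s t = ∑𝔹 (λ h → ∑𝔹 (λ i → Coord.Adj-coeff a (lookup j a) e * L a h (lookup j a ∧ e) i s t))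
    inner≈K : ∀ b h i → ⊗ (λ a → inner b h a (lookup i a)) ≈ₘ (∏[ a < n ] coeff b a) • K h (j ∩ b) i
    inner≈K b h i = ≈ₘ-trans (⊗-cong (λ a s t → *-congˡ (reflexive (≡.cong (λ e → L a (lookup h a) e (lookup i a) s t)
                                                                            (≡.sym (lookup-zipWith _∧_ a j b))))))
                             (⊗-scale _ (Kᶠ h (j ∩ b) i))

  1ₘ≈A⊥ : 1ₘ ≈ₘ A ⊥
  1ₘ≈A⊥ = ≈ₘ-trans 1ₘ-⊗ (≈ₘ-trans (⊗-cong δ≈Adj⊥) (≈ₘ-sym (A-⊗ ⊥)))
    where
    δ≈Adj⊥ : ∀ a s t → δ s t ≈ Coord.Adj a (lookup ⊥ a) s t
    δ≈Adj⊥ a s t = reflexive (≡.cong (λ e → Coord.Adj a e s t) (≡.sym (lookup-replicate a false)))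

  T⊆Span : ∀ {M} → InT M → Span AnyK M
  T⊆Span (genA j)     = A∈Span j
  T⊆Span (genE h)     = resp (K∈AnyK h ⊥ h) (≈ₘ-sym (E*-K h))
  T⊆Span one          = resp (A∈Span ⊥) (≈ₘ-sym 1ₘ≈A⊥)
  T⊆Span (add M N)    = add (T⊆Span M) (T⊆Span N)
  T⊆Span (scal k M)   = scal k (T⊆Span M)
  T⊆Span (mul M N)    = Span-*ₘ AnyK-*ₘ (T⊆Span M) (T⊆Span N)
  T⊆Span (resp M M≈)  = resp (T⊆Span M) M≈

  E*∈Span : ∀ g → Span (DiagK g) (E* g)
  E*∈Span g = gen (lift (⊥ , E*-K g))

  ETE⊆Span : ∀ g {N} → ETE g N → Span (DiagK g) N
  ETE⊆Span g (M , M∈T , N≈) =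
    resp (Span-*ₘ (RowK-*ₘ-DiagK {g}) (Span-*ₘ (DiagK-*ₘ-AnyK {g}) (E*∈Span g) (T⊆Span M∈T)) (E*∈Span g)) (≈ₘ-sym N≈)

  L-tilde : ∀ a G B s t → L a G B G s t ≈ L a G (B ∧ (G ∧ (2 <ᵇ u a))) G s t
  L-tilde a G false s t = refl
  L-tilde a G true  s t with G ∧ (2 <ᵇ u a) in eq
  ... | true  = refl
  ... | false = Coord.L-true≈L-false a G eq s t

  K-tilde : ∀ g b → K g b g ≈ₘ K g (b ∩ tilde g) g
  K-tilde g b = ⊗-cong (λ a s t → trans (L-tilde a (lookup g a) (lookup b a) s t)
    (reflexive (≡.cong (λ e → L a (lookup g a) e (lookup g a) s t) (≡.sym (lookup-∩-tilde a)))))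
    where
    lookup-∩-tilde : ∀ a → lookup (b ∩ tilde g) a ≡ lookup b a ∧ (lookup g a ∧ (2 <ᵇ u a))
    lookup-∩-tilde a = ≡.trans (lookup-zipWith _∧_ a b (tilde g)) (≡.cong (lookup b a ∧_) (lookup∘tabulate _ a))

  natF-k-mono : ∀ {a d} → a ⊆ d → natF (k a) ≈ 0# → natF (k d) ≈ 0#
  natF-k-mono {a} {d} a⊆d ka≈0 = begin
    natF (k d)                                                    ≈⟨ natF-k d ⟩
    ∏[ c < n ] size c (lookup d c)                                ≈⟨ ∏-cong n (λ c → split c (lookup a c) ≡.refl) ⟩
    ∏[ c < n ] (size c (lookup a c) * size c (lookup d c ∧ not (lookup a c))) ≈⟨ ∏-distrib-* n _ _ ⟩
    ∏[ c < n ] size c (lookup a c) * _                            ≈⟨ *-congʳ (trans (sym (natF-k a)) ka≈0) ⟩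
    0# * _                                                        ≈⟨ zeroˡ _ ⟩
    0#                                                            ∎
    where
    split : ∀ c e → lookup a c ≡ e → size c (lookup d c) ≈ size c e * size c (lookup d c ∧ not e)
    split c true  ac≡true rewrite []=⇒lookup (a⊆d (lookup⇒[]= c a ac≡true)) = sym (*-identityʳ _)
    split c false _       rewrite B.∧-identityʳ (lookup d c) = sym (*-identityˡ _)

  Span-bind : ∀ {S S′ : Pred} → (∀ {M} → S M → Span S′ M) → ∀ {M} → Span S M → Span S′ M
  Span-bind f zeroₛ        = zeroₛ
  Span-bind f (gen M∈S)    = f M∈S
  Span-bind f (add M N)    = add (Span-bind f M) (Span-bind f N)
  Span-bind f (scal k M)   = scal k (Span-bind f M)
  Span-bind f (resp M M≈)  = resp (Span-bind f M) M≈

  weight : Subset n → Subset n → Subset n → Carrier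
  weight g a b = ∏[ c < n ] (if lookup a c ∧ lookup b c then size c (lookup g c) else 1#)

  K-diag-*ₘ : ∀ g a b → K g a g *ₘ K g b g ≈ₘ weight g a b • K g (a ∪ b) g
  K-diag-*ₘ g a b = ≈ₘ-trans (K-*ₘ g a g g b g)
    (•-congʳ (K g (a ∪ b) g) (∏-cong n (λ c → Coord.L-coeff-diag c (lookup g c) (lookup a c) (lookup b c))))

  weight-≈0 : ∀ {g a b y} → y ∈ a → y ∈ b → size y (lookup g y) ≈ 0# → weight g a b ≈ 0#
  weight-≈0 {g} {a} {b} {y} y∈a y∈b size≈0 = ∏-≈0 n y (trans
    (reflexive (≡.cong₂ (λ e f → if e ∧ f then size y (lookup g y) else 1#) ([]=⇒lookup y∈a) ([]=⇒lookup y∈b))) size≈0)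

  weight-⁅⁆ : ∀ {g b y} → y ∉ b → weight g ⁅ y ⁆ b ≈ 1#
  weight-⁅⁆ {g} {b} {y} y∉b = ∏-≈1 n factor
    where
    factor : ∀ c → (if lookup ⁅ y ⁆ c ∧ lookup b c then size c (lookup g c) else 1#) ≈ 1#
    factor c with lookup ⁅ y ⁆ c in c∈⁅y⁆ | lookup b c in c∈b
    ... | false | _     = refl
    ... | true  | false = refl
    ... | true  | true  = ⊥-elim (y∉b (≡.subst (_∈ b) (x∈⁅y⁆⇒x≡y y (lookup⇒[]= c ⁅ y ⁆ c∈⁅y⁆)) (lookup⇒[]= c b c∈b)))

  weight-⊥ : ∀ g a → weight g a ⊥ ≈ 1#
  weight-⊥ g a = ∏-≈1 n factor
    where
    factor : ∀ c → (if lookup a c ∧ lookup ⊥ c then size c (lookup g c) else 1#) ≈ 1#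
    factor c rewrite lookup-replicate c false | B.∧-zeroʳ (lookup a c) = refl

  weight-⊆ : ∀ {g a b} → a ⊆ g → a ⊆ b → weight g a b ≈ natF (k a)
  weight-⊆ {g} {a} {b} a⊆g a⊆b = trans (∏-cong n factor) (sym (natF-k a))
    where
    factor : ∀ c → (if lookup a c ∧ lookup b c then size c (lookup g c) else 1#) ≈ size c (lookup a c)
    factor c with lookup a c in c∈a
    ... | false = refl
    ... | true rewrite []=⇒lookup (a⊆b (lookup⇒[]= c a c∈a)) | []=⇒lookup (a⊆g (lookup⇒[]= c a c∈a)) = refl

  tilde⊆ : ∀ g → tilde g ⊆ g
  tilde⊆ g {y} y∈g̃ = lookup⇒[]= y g (conjunct₁ (≡.trans (≡.sym (lookup∘tabulate _ y)) ([]=⇒lookup y∈g̃)))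
    where
    conjunct₁ : ∀ {p q} → p ∧ q ≡ true → p ≡ true
    conjunct₁ {true} _ = ≡.refl

  natF-u≈size+1 : ∀ y → natF (u y) ≈ size y true + 1#
  natF-u≈size+1 y = trans (natF≈∑1 (u y)) (sym (Coord.size-true+1 y))

  size≈0⇒natF-u≈1 : ∀ y → size y true ≈ 0# → natF (u y) ≈ 1#
  size≈0⇒natF-u≈1 y size≈0 = trans (natF-u≈size+1 y) (trans (+-congʳ size≈0) (+-identityˡ 1#))

  natF-u≈1⇒size≈0 : ∀ y → natF (u y) ≈ 1# → size y true ≈ 0#
  natF-u≈1⇒size≈0 y natF≈1 = +-cancelʳ 1# _ _ (trans (sym (natF-u≈size+1 y)) (trans natF≈1 (sym (+-identityˡ 1#))))

  B-K-*ₘ : ∀ {g a b M N} → M ≈ₘ B g a g → N ≈ₘ K g b g → M *ₘ N ≈ₘ weight g a b • K g (a ∪ b) g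
  B-K-*ₘ {g} {a} {b} M≈ N≈ = ≈ₘ-trans (*ₘ-cong (≈ₘ-trans M≈ (B-K g a)) N≈) (K-diag-*ₘ g a b)

  module Ideal (g : Subset n) where

    ETE-subspace : ∀ {M} → Span (ETE g) M → ETE g M
    ETE-subspace zeroₛ = 0ₘ , T-zero , ≈ₘ-sym (≈ₘ-trans (*ₘ-cong (*ₘ-zeroʳ _) ≈ₘ-refl) (*ₘ-zeroˡ _))
      where
      T-zero : InT 0ₘ
      T-zero = resp (scal 0# one) (λ v w → zeroˡ _)
    ETE-subspace (gen M∈ETE) = M∈ETE
    ETE-subspace (add M N) with ETE-subspace M | ETE-subspace N
    ... | M′ , M′∈T , M≈ | N′ , N′∈T , N≈ = M′ +ₘ N′ , add M′∈T N′∈T ,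
      ≈ₘ-trans (+ₘ-cong M≈ N≈)
               (≈ₘ-sym (≈ₘ-trans (*ₘ-cong (*ₘ-distribˡ-+ₘ _ _ _) ≈ₘ-refl) (*ₘ-distribʳ-+ₘ _ _ _)))
    ETE-subspace (scal k M) with ETE-subspace M
    ... | M′ , M′∈T , M≈ = k • M′ , scal k M′∈T ,
      ≈ₘ-trans (•-congˡ M≈) (≈ₘ-sym (≈ₘ-trans (*ₘ-cong (*ₘ-• _ _ _) ≈ₘ-refl) (•-*ₘ _ _ _)))
    ETE-subspace (resp M M≈N) with ETE-subspace M
    ... | M′ , M′∈T , M≈ = M′ , M′∈T , ≈ₘ-trans (≈ₘ-sym M≈N) M≈

    B∈ETE : ∀ a → ETE g (B g a g)
    B∈ETE a = ETE-subspace (Span-sumₘ (filterᵇ (λ j → ⌊ (g ⊕ˢ g) ⊆? j ⌋ ∧ ⌊ j ⊆? a ⌋) (allSubsets n)) _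
                                      (λ j → gen (A j , genA j , ≈ₘ-refl)))

    I⊆ETE : ∀ {M} → I g M → ETE g M
    I⊆ETE M∈I = ETE-subspace (Span-bind (λ { (lift (a , _ , _ , M≈)) → resp (gen (B∈ETE a)) (≈ₘ-sym M≈) }) M∈I)

    K∈I : ∀ {a d} → a ⊆ tilde g → natF (k a) ≈ 0# → a ⊆ d → I g (K g d g)
    K∈I {a} {d} a⊆g̃ ka≈0 a⊆d =
      resp (gen (lift (d ∩ tilde g , p∩q⊆q d (tilde g) , natF-k-mono a⊆d∩g̃ ka≈0 , ≈ₘ-refl)))
           (≈ₘ-sym (≈ₘ-trans (K-tilde g d) (≈ₘ-sym (B-K g (d ∩ tilde g)))))
      where
      a⊆d∩g̃ : a ⊆ d ∩ tilde g
      a⊆d∩g̃ y∈a = x∈p∩q⁺ (a⊆d y∈a , a⊆g̃ y∈a)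

    DiagK-*ₘ-Igen : ∀ {P M} → DiagK g P → Igen g M → Span (Igen g) (P *ₘ M)
    DiagK-*ₘ-Igen (lift (b , P≈)) (lift (a , a⊆g̃ , ka≈0 , M≈)) =
      resp (scal _ (K∈I a⊆g̃ ka≈0 (q⊆p∪q b a)))
           (≈ₘ-sym (≈ₘ-trans (*ₘ-cong P≈ (≈ₘ-trans M≈ (B-K g a))) (K-diag-*ₘ g b a)))

    Igen-*ₘ-DiagK : ∀ {M P} → Igen g M → DiagK g P → Span (Igen g) (M *ₘ P)
    Igen-*ₘ-DiagK (lift (a , a⊆g̃ , ka≈0 , M≈)) (lift (b , P≈)) =
      resp (scal _ (K∈I a⊆g̃ ka≈0 (p⊆p∪q b)))
           (≈ₘ-sym (B-K-*ₘ {g} {a} {b} M≈ P≈))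

    isTwoSidedIdeal : IsTwoSidedIdeal (ETE g) (I g)
    isTwoSidedIdeal = record
      { sub   = I⊆ETE
      ; zeroJ = zeroₛ
      ; addJ  = add
      ; scalJ = scal
      ; mulˡ  = λ N∈ETE M∈I → Span-*ₘ DiagK-*ₘ-Igen (ETE⊆Span g N∈ETE) M∈I
      ; mulʳ  = λ M∈I N∈ETE → Span-*ₘ Igen-*ₘ-DiagK M∈I (ETE⊆Span g N∈ETE)
      }

  RaisesDegree : Subset n → Subset n → Set ℓ
  RaisesDegree g W = ∀ a → a ⊆ tilde g → natF (k a) ≈ 0# → ∀ b →
                     weight g a b ≈ 0# ⊎ Σ (Fin n) λ y → y ∈ a × y ∈ W × y ∉ b

  module Nilpotency (g W : Subset n) (raises : RaisesDegree g W) where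

    Degree≥ : ℕ → Pred
    Degree≥ m M = Lift c (Σ (Subset n) λ b → m ≤ ∣ b ∩ W ∣ × M ≈ₘ K g b g)

    Igen-*ₘ-Degree≥ : ∀ {m M N} → Igen g M → Degree≥ m N → Span (Degree≥ (suc m)) (M *ₘ N)
    Igen-*ₘ-Degree≥ (lift (a , a⊆g̃ , ka≈0 , M≈)) (lift (b , m≤ , N≈)) with raises a a⊆g̃ ka≈0 b
    ... | inj₁ weight≈0 =
      resp zeroₛ (≈ₘ-sym (≈ₘ-trans (B-K-*ₘ {g} {a} {b} M≈ N≈) (λ v w → trans (*-congʳ weight≈0) (zeroˡ _))))
    ... | inj₂ (y , y∈a , y∈W , y∉b) =
      resp (scal _ (gen (lift (a ∪ b , ℕ.≤-trans (s≤s m≤) (∣q∩r∣<∣p∪q∩r∣ y∈a y∈W y∉b) , ≈ₘ-refl))))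
           (≈ₘ-sym (B-K-*ₘ {g} {a} {b} M≈ N≈))

    Igen⊆Degree≥1 : ∀ {M} → Igen g M → Span (Degree≥ 1) M
    Igen⊆Degree≥1 (lift (a , a⊆g̃ , ka≈0 , M≈)) with raises a a⊆g̃ ka≈0 ⊥
    ... | inj₁ weight≈0             = ⊥-elim (1≉0 (trans (sym (weight-⊥ g a)) weight≈0))
    ... | inj₂ (y , y∈a , y∈W , _) = gen (lift (a , x∈p⇒∣p∣≥1 (x∈p∩q⁺ (y∈a , y∈W)) , ≈ₘ-trans M≈ (B-K g a)))

    Degree≥-*ₘ-1ₘ : ∀ {m M N} → Degree≥ m M → Lift c (N ≈ₘ 1ₘ) → Span (Degree≥ m) (M *ₘ N)
    Degree≥-*ₘ-1ₘ (lift (b , m≤ , M≈)) (lift N≈) = gen (lift (b , m≤ , ≈ₘ-trans (*ₘ-cong M≈ N≈) (K-*ₘ-1ₘ g b g)))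

    prodV-Degree≥ : ∀ h (Ms : Vec Mat (suc h)) → (∀ i → I g (lookup Ms i)) → Span (Degree≥ (suc h)) (prodV Ms)
    prodV-Degree≥ zero    (M Vec.∷ Vec.[]) Ms∈I =
      Span-*ₘ Degree≥-*ₘ-1ₘ (Span-bind Igen⊆Degree≥1 (Ms∈I zero)) (gen (lift ≈ₘ-refl))
    prodV-Degree≥ (suc h) (M Vec.∷ Ms)     Ms∈I =
      Span-*ₘ Igen-*ₘ-Degree≥ (Ms∈I zero) (prodV-Degree≥ h Ms (λ i → Ms∈I (suc i)))

    Degree>∣W∣⇒≈0 : ∀ {M} → Span (Degree≥ (suc ∣ W ∣)) M → M ≈ₘ 0ₘ
    Degree>∣W∣⇒≈0 zeroₛ                      = ≈ₘ-refl
    Degree>∣W∣⇒≈0 (gen (lift (b , W<∣b∩W∣ , _))) = ⊥-elim (ℕ.<⇒≱ W<∣b∩W∣ (∣p∩q∣≤∣q∣ b W))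
    Degree>∣W∣⇒≈0 (add M N) v w  = trans (+-cong (Degree>∣W∣⇒≈0 M v w) (Degree>∣W∣⇒≈0 N v w)) (+-identityˡ _)
    Degree>∣W∣⇒≈0 (scal k M) v w = trans (*-congˡ (Degree>∣W∣⇒≈0 M v w)) (zeroʳ _)
    Degree>∣W∣⇒≈0 (resp M M≈N)   = ≈ₘ-trans (≈ₘ-sym M≈N) (Degree>∣W∣⇒≈0 M)

    I-prodZero : ProdZero (I g) (suc ∣ W ∣)
    I-prodZero Ms Ms∈I = Degree>∣W∣⇒≈0 (prodV-Degree≥ ∣ W ∣ Ms Ms∈I)

  -- W = ⊤ gives nilpotency without deciding which uₐ are ≡ 1 in F.
  raises-⊤ : ∀ g → RaisesDegree g ⊤
  raises-⊤ g a a⊆g̃ ka≈0 b with any? (λ y → (y ∈? a) ×-dec ¬? (y ∈? b))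
  ... | yes (y , y∈a , y∉b) = inj₂ (y , y∈a , ∈⊤ , y∉b)
  ... | no ∄y∈a─b = inj₁ (trans (weight-⊆ (λ y∈a → tilde⊆ g (a⊆g̃ y∈a)) a⊆b) ka≈0)
    where
    a⊆b : a ⊆ b
    a⊆b {y} y∈a = decidable-stable (y ∈? b) (λ y∉b → ∄y∈a─b (y , y∈a , y∉b))

  module Exceptional (g S : Subset n) (S-spec : ∀ a → (a ∈ S) ⇔ (a ∈ g × natF (u a) ≈ 1#)) where

    raises-S : RaisesDegree g S
    raises-S a a⊆g̃ ka≈0 b with any? (λ y → (y ∈? a) ×-dec (y ∈? S) ×-dec ¬? (y ∈? b))
    ... | yes (y , y∈a , y∈S , y∉b) = inj₂ (y , y∈a , y∈S , y∉b)
    ... | no ∄y∈a∩S─b with any? (λ y → (y ∈? a) ×-dec (y ∈? S))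
    ...   | yes (y , y∈a , y∈S) = inj₁ (weight-≈0 {g} y∈a y∈b (trans (reflexive (≡.cong (size y) ([]=⇒lookup y∈g))) size≈0))
      where
      y∈b : y ∈ b
      y∈b = decidable-stable (y ∈? b) (λ y∉b → ∄y∈a∩S─b (y , y∈a , y∈S , y∉b))
      y∈g = proj₁ (Equivalence.to (S-spec y) y∈S)
      size≈0 = natF-u≈1⇒size≈0 y (proj₂ (Equivalence.to (S-spec y) y∈S))
    ...   | no ∄y∈a∩S = ⊥-elim (∏-units≉0 1≉0 n _ (λ c → inverse _ (size≉0 c)) (trans (sym (natF-k a)) ka≈0))
      where
      size≉0 : ∀ c → size c (lookup a c) ≉ 0#
      size≉0 c with lookup a c in c∈a
      ... | false = 1≉0
      ... | true  = λ size≈0 → ∄y∈a∩S (c , lookup⇒[]= c a c∈a ,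
              Equivalence.from (S-spec c) (tilde⊆ g (a⊆g̃ (lookup⇒[]= c a c∈a)) , size≈0⇒natF-u≈1 c size≈0))

    module LowerBound (2≤u : ∀ a → 2 ≤ u a) where

      S⊆tilde : S ⊆ tilde g
      S⊆tilde {y} y∈S = lookup⇒[]= y (tilde g) (≡.trans (lookup∘tabulate _ y) (≡.cong₂ _∧_ ([]=⇒lookup y∈g) 2<u))
        where
        y∈g = proj₁ (Equivalence.to (S-spec y) y∈S)
        natF-u≈1 = proj₂ (Equivalence.to (S-spec y) y∈S)
        2<u : (2 <ᵇ u y) ≡ true
        2<u with 2 <ᵇ u y in eq
        ... | true  = ≡.refl
        ... | false = ⊥-elim (1≉0 (trans (sym (+-identityʳ 1#)) (+-cancelˡ 1# _ _ 1+1≈1+0)))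
          where
          1+1≈1+0 : 1# + (1# + 0#) ≈ 1# + 0#
          1+1≈1+0 = trans (reflexive (≡.cong natF (≡.sym (exactly-two (2≤u y) eq))))
                          (trans natF-u≈1 (sym (+-identityʳ 1#)))

      B∈I : ∀ {W y} → W ⊆ S → y ∈ W → I g (B g W g)
      B∈I {W} {y} W⊆S y∈W = gen (lift (W , (λ z∈W → S⊆tilde (W⊆S z∈W)) , kW≈0 , ≈ₘ-refl))
        where
        kW≈0 : natF (k W) ≈ 0#
        kW≈0 = trans (natF-k W) (∏-≈0 n y (trans (reflexive (≡.cong (size y) ([]=⇒lookup y∈W)))
                                                (natF-u≈1⇒size≈0 y (proj₂ (Equivalence.to (S-spec y) (W⊆S y∈W))))))

      K≉0 : ∀ b → ¬ (K g b g ≈ₘ 0ₘ)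
      K≉0 b K≈0 = 1≉0 (trans (sym (∏-≈1 n (λ a → proj₂ (witness a)))) (K≈0 v v))
        where
        witness : ∀ a → Σ (Fin (u a)) λ s → L a (lookup g a) (lookup b a) (lookup g a) s s ≈ 1#
        witness a = Coord.L-witness a (2≤u a) (lookup g a) (lookup b a)
        v : X
        v a = proj₁ (witness a)

      product≈K : ∀ h W → W ⊆ S → suc h ≤ ∣ W ∣ →
                  Σ (Vec Mat (suc h)) λ Ms → (∀ i → I g (lookup Ms i)) × Σ (Subset n) λ b → b ⊆ W × prodV Ms ≈ₘ K g b g
      product≈K zero W W⊆S 1≤∣W∣ =
        (B g W g Vec.∷ Vec.[]) , (λ { zero → B∈I W⊆S (proj₂ (∣p∣≥1⇒nonempty 1≤∣W∣)) }) ,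
        W , (λ y∈W → y∈W) , ≈ₘ-trans (*ₘ-cong (B-K g W) ≈ₘ-refl) (K-*ₘ-1ₘ g W g)
      product≈K (suc h) W W⊆S 2+h≤∣W∣ with ∣p∣≥1⇒nonempty (ℕ.≤-trans (s≤s z≤n) 2+h≤∣W∣)
      ... | y , y∈W with product≈K h (W ─ ⁅ y ⁆) (λ z∈ → W⊆S (p─q⊆p W ⁅ y ⁆ z∈))
                                   (ℕ.≤-pred (ℕ.≤-trans 2+h≤∣W∣ (ℕ.≤-reflexive (∣p∣≡1+∣p─⁅x⁆∣ y∈W))))
      ...   | Ms , Ms∈I , b , b⊆W─y , prod≈ = (B g ⁅ y ⁆ g Vec.∷ Ms) , M∷Ms∈I , ⁅ y ⁆ ∪ b , ⁅y⁆∪b⊆W ,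
        ≈ₘ-trans (B-K-*ₘ {g} {⁅ y ⁆} {b} ≈ₘ-refl prod≈)
                 (λ v w → trans (*-congʳ (weight-⁅⁆ {g} (λ y∈b → x∉p─⁅x⁆ W (b⊆W─y y∈b)))) (*-identityˡ _))
        where
        ⁅y⁆⊆W : ⁅ y ⁆ ⊆ W
        ⁅y⁆⊆W z∈⁅y⁆ = ≡.subst (_∈ W) (≡.sym (x∈⁅y⁆⇒x≡y y z∈⁅y⁆)) y∈W
        M∷Ms∈I : ∀ i → I g (lookup (B g ⁅ y ⁆ g Vec.∷ Ms) i)
        M∷Ms∈I zero    = B∈I (λ z∈ → W⊆S (⁅y⁆⊆W z∈)) (x∈⁅x⁆ y)
        M∷Ms∈I (suc i) = Ms∈I i
        ⁅y⁆∪b⊆W : ⁅ y ⁆ ∪ b ⊆ W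
        ⁅y⁆∪b⊆W z∈ with x∈p∪q⁻ ⁅ y ⁆ b z∈
        ... | inj₁ z∈⁅y⁆ = ⁅y⁆⊆W z∈⁅y⁆
        ... | inj₂ z∈b   = p─q⊆p W ⁅ y ⁆ (b⊆W─y z∈b)

      not-prodZero : ∀ h → 1 ≤ h → h < suc ∣ S ∣ → ¬ ProdZero (I g) h
      not-prodZero (suc h) _ (s≤s h+1≤∣S∣) prodZero with product≈K h S (λ y∈S → y∈S) h+1≤∣S∣
      ... | Ms , Ms∈I , b , _ , prod≈ = K≉0 b (≈ₘ-trans (≈ₘ-sym prod≈) (prodZero Ms Ms∈I))

lemma6p4 : ∀ {c ℓ : Level} (F : Field c ℓ) (n : ℕ) (u : Fin n → ℕ) →
    (∀ a → 2 ≤ u a) → (x : Pt n u) → (g : Subset n) →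
    let open Field F
        open Setting F n u x
    in IsTwoSidedIdeal (ETE g) (I g) × IsNilpotent (I g) ×
       ((S : Subset n) → (∀ a → (a ∈ S) ⇔ (a ∈ g × natF (u a) ≈ 1#)) →
        NilpotencyIndex (I g) (suc ∣ S ∣))
lemma6p4 F n u 2≤u x g =
  Ideal.isTwoSidedIdeal g ,
  (suc ∣ ⊤ {n} ∣ , s≤s z≤n , Nilpotency.I-prodZero g ⊤ (raises-⊤ g)) ,
  λ S S-spec → let open Exceptional g S S-spec in
    s≤s z≤n , Nilpotency.I-prodZero g S raises-S , LowerBound.not-prodZero 2≤u
  where open FactorialScheme F n u x
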